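{- Let $\Phi=(X,\mathcal{C})$ be an instance of MNAE3SAT and let $G=(V,A\cup E)$ be the mixed graph constructed from $\Phi$ as described in the context. An orientation $\vec G=(V,A\cup\vec E)$ of $G$ is 2-vertex-connected if and only if all of the following hold: (a) for every $x\in X$, the edges of the cycle $B^x$ are either all oriented as $b^x_ib^x_{i+1}$ for $i=1,\dots,3\mu(x)$ together with $b^x_{3\mu(x)+1}b^x_1$ (call this orientation $\overrightarrow{B^x}$), or all oriented in the reverse direction, i.e. as $b^x_{i+1}b^x_i$ and $b^x_1b^x_{3\mu(x)+1}$ (call this $\overleftarrow{B^x}$); (b) for every pair $(x,C)$ with $x\in C\in\mathcal{C}$, the edge $z_Cu^x_C$ is oriented from $u^x_C$ to $z_C$ if and only if $B^x$ is oriented as $\overrightarrow{B^x}$; (c) for every $C\in\mathcal{C}$ there exist $x_1,x_2\in C$ such that the edge $z_Cu^{x_1}_C$ is oriented from $u^{x_1}_C$ to $z_C$ and the edge $z_Cu^{x_2}_C$ is oriented from $z_C$ to $u^{x_2}_C$.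
   Context: MNAE3SAT instance: a finite set $X$ of boolean variables and a set $\mathcal{C}$ of clauses, each clause being a set of 3 distinct (non-negated) variables. Let $P(\Phi)$ be the set of pairs $(x,C)$ with $x\in C\in\mathcal{C}$. Construction of $G=(V,A\cup E)$: $V$ consists of three vertices $p,q,r$, one vertex $z_C$ for every $C\in\mathcal{C}$, and for every $(x,C)\in P(\Phi)$ four vertices $t^x_C,u^x_C,w^x_C,y^x_C$ (all distinct). $A$ consists of the arcs $pq,qp,pr,rp,qr,rq$; for every $C\in\mathcal{C}$ the arcs $pz_C$ and $z_Cq$; and for every $(x,C)\in P(\Phi)$ the arcs $pt^x_C,\ t^x_Cu^x_C,\ u^x_Cy^x_C,\ y^x_Cu^x_C,\ u^x_Cw^x_C,\ w^x_Cq$. $E$ consists of an edge $z_Cu^x_C$ for every $(x,C)\in P(\Phi)$, and, for every $x\in X$, with $C_1,\dots,C_{\mu(x)}$ an arbitrary fixed ordering of the clauses containing $x$, setting $b^x_1=r$ and $b^x_{3i-1}=y^x_{C_i}$, $b^x_{3i}=w^x_{C_i}$, $b^x_{3i+1}=t^x_{C_i}$ for $i=1,\dots,\mu(x)$, the edges of the cycle $B^x=b^x_1b^x_2\cdots b^x_{3\mu(x)+1}b^x_1$. An orientation of a mixed graph keeps all arcs of $A$ and replaces each edge $uv\in E$ by exactly one of the arcs $uv$, $vu$. A digraph is 2-vertex-connected if it has at least 3 vertices and for any two vertices $u,v$ there are two directed $uv$-paths sharing no vertices other than $u,v$. -}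

module Defs where

open import Data.Nat using (ℕ; zero; suc)
open import Data.Fin using (Fin; zero; suc)
open import Data.Bool using (Bool; true; false)
open import Data.List using (List; []; _∷_; length; concatMap)
open import Data.List.Membership.Propositional using (_∈_)
open import Data.List.Relation.Unary.All using (All)
open import Data.List.Relation.Unary.Unique.Propositional using (Unique)
open import Data.Product using (Σ; ∃; ∃-syntax; _×_; _,_)
open import Data.Sum using (_⊎_)
open import Function.Bundles using (_⇔_)
open import Function.Definitions using (Injective)
open import Relation.Binary.PropositionalEquality using (_≡_; _≢_)

data Walk {V : Set} (R : V → V → Set) : V → V → List V → Set where
  stop : ∀ {a} → Walk R a a (a ∷ [])
  step : ∀ {a b c vs} → R a b → Walk R b c vs → Walk R a c (a ∷ vs)

IsPath : {V : Set} (R : V → V → Set) → V → V → List V → Set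
IsPath R a b vs = Walk R a b vs × Unique vs

TwoVertexConnected : {V : Set} (R : V → V → Set) → Set
TwoVertexConnected {V} R =
  (Σ V λ a → Σ V λ b → Σ V λ c → a ≢ b × a ≢ c × b ≢ c) ×
  (∀ a b → a ≢ b →
    Σ (List V) λ P₁ → Σ (List V) λ P₂ →
      IsPath R a b P₁ × IsPath R a b P₂ × P₁ ≢ P₂ ×
      (∀ v → v ∈ P₁ → v ∈ P₂ → v ≡ a ⊎ v ≡ b))

-- MNAE3SAT instances: variables Fin n, clauses indexed by Fin m; clause c
-- is the set {cl c 0, cl c 1, cl c 2} of 3 distinct variables, and distinct
-- indices give distinct clauses (𝒞 is a set).

record Instance : Set where
  field
    n m      : ℕ
    cl       : Fin m → Fin 3 → Fin n
    cl-inj   : ∀ c → Injective _≡_ _≡_ (cl c)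
    cl-set   : ∀ c d → (∀ x → (∃[ j ] cl c j ≡ x) ⇔ (∃[ j ] cl d j ≡ x)) → c ≡ d

-- For each variable x, an arbitrary fixed ordering C₁,…,C_μ(x) of the
-- clauses containing x; each clause is recorded together with the
-- (unique) position j at which x occurs in it, i.e. a pair (C,j) with
-- cl C j ≡ x represents the pair (x,C) ∈ P(Φ).
record Ordering (I : Instance) : Set where
  open Instance I
  field
    ord       : Fin n → List (Fin m × Fin 3)
    ord-sound : ∀ x → All (λ cj → cl (Data.Product.proj₁ cj) (Data.Product.proj₂ cj) ≡ x) (ord x)
    ord-uniq  : ∀ x → Unique (ord x)
    ord-compl : ∀ x c j → cl c j ≡ x → (c , j) ∈ ord x

-- Vertices of G: p, q, r, z_C, and t,u,w,y for each pair (x,C), the pair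
-- being represented by (C, position of x in C).

data Vtx (m : ℕ) : Set where
  p q r      : Vtx m
  z          : Fin m → Vtx m
  t u w y    : Fin m → Fin 3 → Vtx m

module Construction (I : Instance) (O : Ordering I) where
  open Instance I
  open Ordering O

  -- the cycle B^x as the vertex list b₁ b₂ … b_{3μ(x)+1}
  -- = r, y_{C₁}, w_{C₁}, t_{C₁}, …, y_{C_μ}, w_{C_μ}, t_{C_μ}
  Bs : Fin n → List (Vtx m)
  Bs x = r ∷ concatMap (λ cj → y (Data.Product.proj₁ cj) (Data.Product.proj₂ cj)
                             ∷ w (Data.Product.proj₁ cj) (Data.Product.proj₂ cj)
                             ∷ t (Data.Product.proj₁ cj) (Data.Product.proj₂ cj) ∷ [])
                       (ord x)

  -- number of edges (= vertices) of B^x, i.e. 3μ(x)+1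
  len : Fin n → ℕ
  len x = length (Bs x)

  b : (x : Fin n) → Fin (len x) → Vtx m
  b x k = Data.List.lookup (Bs x) k

  -- cyclic successor of an index
  next : ∀ {k} → Fin (suc k) → Fin (suc k)
  next {zero}  zero    = zero
  next {suc k} zero    = suc zero
  next {suc k} (suc i) = wrap (next i)
    where
    wrap : Fin (suc k) → Fin (suc (suc k))
    wrap zero    = zero
    wrap (suc j) = suc (suc j)

  -- An orientation of E:
  --  zu c j = true  means edge z_C u^x_C is oriented u^x_C → z_C
  --  cyc x k = true means the k-th edge of B^x (between b_k and b_{k+1},
  --  indices cyclic) is oriented b_k → b_{k+1}
  record Orientation : Set where
    field
      zu  : Fin m → Fin 3 → Bool
      cyc : (x : Fin n) → Fin (len x) → Bool

  data Arc (Or : Orientation) : Vtx m → Vtx m → Set where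
    pq : Arc Or p q
    qp : Arc Or q p
    pr : Arc Or p r
    rp : Arc Or r p
    qr : Arc Or q r
    rq : Arc Or r q
    pz : ∀ c → Arc Or p (z c)
    zq : ∀ c → Arc Or (z c) q
    pt : ∀ c j → Arc Or p (t c j)
    tu : ∀ c j → Arc Or (t c j) (u c j)
    uy : ∀ c j → Arc Or (u c j) (y c j)
    yu : ∀ c j → Arc Or (y c j) (u c j)
    uw : ∀ c j → Arc Or (u c j) (w c j)
    wq : ∀ c j → Arc Or (w c j) q
    uz : ∀ c j → Orientation.zu Or c j ≡ true  → Arc Or (u c j) (z c)
    zu : ∀ c j → Orientation.zu Or c j ≡ false → Arc Or (z c) (u c j)
    fw : ∀ x (k : Fin (len x)) → Orientation.cyc Or x k ≡ true  →
         Arc Or (b x k) (b x (next k))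
    bw : ∀ x (k : Fin (len x)) → Orientation.cyc Or x k ≡ false →
         Arc Or (b x (next k)) (b x k)

  Forward : Orientation → Fin n → Set
  Forward Or x = ∀ k → Orientation.cyc Or x k ≡ true

  Backward : Orientation → Fin n → Set
  Backward Or x = ∀ k → Orientation.cyc Or x k ≡ false

  CondA : Orientation → Set
  CondA Or = ∀ x → Forward Or x ⊎ Backward Or x

  CondB : Orientation → Set
  CondB Or = ∀ c j → (Orientation.zu Or c j ≡ true) ⇔ Forward Or (cl c j)

  CondC : Orientation → Set
  CondC Or = ∀ c → Σ (Fin 3) λ j₁ → Σ (Fin 3) λ j₂ →
               Orientation.zu Or c j₁ ≡ true × Orientation.zu Or c j₂ ≡ false

{-# OPTIONS --safe #-}
module Submission where

-- A digraph on at least three vertices in which every vertex has two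
-- out-neighbours other than itself, and which stays strongly connected after deleting any one
-- vertex, is 2-vertex-connected: two a–b paths are grown by the leapfrog argument behind
-- Menger's theorem, rerouting around their current meeting vertex until it reaches b. Under
-- (a)–(c) every vertex v of G has two walks into the complete triangle pqr meeting only at v,
-- and two walks from the triangle into v meeting only at v, which gives both hypotheses.
--
-- If (a), (b) or (c) fails, some vertex set can only be left (or only be entered)
-- through a single vertex, which then separates it from p or q: a vertex other than r at which
-- the orientation of B^x turns has a single out- or in-neighbour; if B^x is forward while
-- z_C → u^x_C, the set {u, y} can only be left through w; if B^x is backward while u^x_C → z_C,
-- the set {u, y, w} can only be entered through t; and if the three edges at z_C point the same
-- way, z_C has a single out- or in-neighbour.

open import Data.Bool using (true; false)
open import Data.Empty using (⊥; ⊥-elim)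
open import Data.Fin using (Fin; zero; suc; inject₁; fromℕ)
import Data.Fin.Properties as Fin
open import Data.List using (List; []; _∷_; _++_; _∷ʳ_; [_]; length; concatMap; lookup; reverse)
open import Data.List.Properties using (++-assoc; length-++; unfold-reverse; ʳ++-defn; reverse-++)
open import Data.List.Membership.Propositional using (_∈_; _∉_; find)
open import Data.List.Membership.Propositional.Properties using (∈-++⁺ˡ; ∈-++⁺ʳ; ∈-++⁻; ∈-concatMap⁻; ∈-∃++; ∈-lookup)
open import Data.List.Relation.Binary.Disjoint.Propositional using (Disjoint)
open import Data.List.Relation.Unary.All as All using (All)
import Data.List.Relation.Unary.All.Properties as All
open import Data.List.Relation.Unary.AllPairs using ([]; _∷_)
open import Data.List.Relation.Unary.Any using (here; there)
import Data.List.Relation.Unary.Any.Properties as Any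
open import Data.List.Relation.Unary.Unique.Propositional using (Unique)
import Data.List.Relation.Unary.Unique.Propositional.Properties as Unique
open import Data.Maybe using (Maybe; just; nothing)
import Data.Maybe.Properties as Maybe
open import Data.Nat using (ℕ; zero; suc; _<_; s≤s)
open import Data.Nat.Properties using (≤-refl; ≤-trans; ≤-pred; m≤n+m)
open import Data.Product using (Σ; ∃; _×_; _,_; proj₁; proj₂; uncurry)
import Data.Product.Properties as Product
open import Data.Sum using (_⊎_; inj₁; inj₂)
import Data.Sum as Sum
import Data.Sum.Properties as Sum
open import Data.Unit using (⊤; tt)
open import Function.Base using (_∘_; case_of_)
open import Function.Bundles using (_⇔_; mk⇔; Equivalence)
open import Relation.Binary.Definitions using (DecidableEquality)
open import Relation.Binary.PropositionalEquality using (_≡_; _≢_; refl; sym; trans; cong; subst; module ≡-Reasoning)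
open import Relation.Nullary using (¬_; Dec; yes; no)
open import Relation.Nullary.Decidable using (map′)
open import Defs using (Walk; stop; step; IsPath; TwoVertexConnected)

module _ {A : Set} where

  ∈-∷ʳ⁻ : ∀ {v b : A} xs → v ∈ xs ∷ʳ b → v ∈ xs ⊎ v ≡ b
  ∈-∷ʳ⁻ xs v∈ with ∈-++⁻ xs v∈
  ... | inj₁ v∈xs = inj₁ v∈xs
  ... | inj₂ (here v≡b) = inj₂ v≡b

  ∈-∷ʳ⁺ : ∀ {v b : A} {xs} → v ∈ xs ⊎ v ≡ b → v ∈ xs ∷ʳ b
  ∈-∷ʳ⁺ (inj₁ v∈xs) = ∈-++⁺ˡ v∈xs
  ∈-∷ʳ⁺ {xs = xs} (inj₂ refl) = ∈-++⁺ʳ xs (here refl)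

  Unique-∷⁺ : ∀ {x : A} {xs} → x ∉ xs → Unique xs → Unique (x ∷ xs)
  Unique-∷⁺ {xs = xs} x∉xs uniq = All.tabulate (λ v∈ x≡v → x∉xs (subst (_∈ xs) (sym x≡v) v∈)) ∷ uniq

  Unique-++⁻ˡ : ∀ (xs : List A) {ys} → Unique (xs ++ ys) → Unique xs
  Unique-++⁻ˡ [] _ = []
  Unique-++⁻ˡ (x ∷ xs) (x∉ ∷ uniq) = All.++⁻ˡ xs x∉ ∷ Unique-++⁻ˡ xs uniq

  Unique-++⁻ʳ : ∀ (xs : List A) {ys} → Unique (xs ++ ys) → Unique ys
  Unique-++⁻ʳ [] uniq = uniq
  Unique-++⁻ʳ (x ∷ xs) (_ ∷ uniq) = Unique-++⁻ʳ xs uniq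

  Unique-++⇒Disjoint : ∀ (xs : List A) {ys} → Unique (xs ++ ys) → Disjoint xs ys
  Unique-++⇒Disjoint (x ∷ xs) (x∉ ∷ uniq) (here refl , v∈ys) = All.lookup (All.++⁻ʳ xs x∉) v∈ys refl
  Unique-++⇒Disjoint (x ∷ xs) (_ ∷ uniq) (there v∈xs , v∈ys) = Unique-++⇒Disjoint xs uniq (v∈xs , v∈ys)

  Unique-∷ʳ⁺ : ∀ {xs : List A} {b} → Unique xs → b ∉ xs → Unique (xs ∷ʳ b)
  Unique-∷ʳ⁺ uniq b∉ = Unique.++⁺ uniq (All.[] ∷ []) λ { (v∈ , here refl) → b∉ v∈ }

  Unique-∷ʳ⁻ : ∀ {xs : List A} {b} → Unique (xs ∷ʳ b) → Unique xs × b ∉ xs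
  Unique-∷ʳ⁻ {xs} uniq = Unique-++⁻ˡ xs uniq , λ b∈ → Unique-++⇒Disjoint xs uniq (b∈ , here refl)

  lookup-injective : ∀ {xs : List A} → Unique xs → ∀ i k → lookup xs i ≡ lookup xs k → i ≡ k
  lookup-injective (_ ∷ _) zero zero _ = refl
  lookup-injective (x∉ ∷ _) zero (suc k) eq = ⊥-elim (All.lookup x∉ (∈-lookup k) eq)
  lookup-injective (x∉ ∷ _) (suc i) zero eq = ⊥-elim (All.lookup x∉ (∈-lookup i) (sym eq))
  lookup-injective (_ ∷ uniq) (suc i) (suc k) eq = cong suc (lookup-injective uniq i k eq)

  length-++-< : ∀ (xs : List A) {ys x} → x ∈ xs → length ys < length (xs ++ ys)
  length-++-< (_ ∷ xs) {ys} _ rewrite length-++ xs {ys} = s≤s (m≤n+m (length ys) (length xs))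

  lastOf : A → List A → A
  lastOf v [] = v
  lastOf _ (v ∷ vs) = lastOf v vs

  lookup-fromℕ : ∀ (v : A) vs → lookup (v ∷ vs) (fromℕ (length vs)) ≡ lastOf v vs
  lookup-fromℕ v [] = refl
  lookup-fromℕ _ (v ∷ vs) = lookup-fromℕ v vs

-- Two disjoint paths in digraphs

module Digraph {V : Set} (_≟_ : DecidableEquality V) (R : V → V → Set) where

  open import Data.List.Membership.DecPropositional _≟_ using (_∈?_)

  -- The vertex list of a walk omits its final vertex, so that walks compose along _++_.
  infixr 5 _▸_
  data Walk⁻ : V → V → List V → Set where
    done : ∀ {a} → Walk⁻ a a []
    _▸_  : ∀ {a c b vs} → R a c → Walk⁻ c b vs → Walk⁻ a b (a ∷ vs)

  infixr 5 _▸▸_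
  _▸▸_ : ∀ {a m b xs ys} → Walk⁻ a m xs → Walk⁻ m b ys → Walk⁻ a b (xs ++ ys)
  done ▸▸ ω = ω
  (e ▸ ω₁) ▸▸ ω = e ▸ (ω₁ ▸▸ ω)

  splitWalk : ∀ {a b} xs {ys} → Walk⁻ a b (xs ++ ys) → ∃ λ m → Walk⁻ a m xs × Walk⁻ m b ys
  splitWalk [] ω = _ , done , ω
  splitWalk (x ∷ xs) (e ▸ ω) with splitWalk xs ω
  ... | m , ω₁ , ω₂ = m , e ▸ ω₁ , ω₂

  splitWalkAt : ∀ {a b} xs c ys → Walk⁻ a b (xs ++ c ∷ ys) → Walk⁻ a c xs × Walk⁻ c b (c ∷ ys)
  splitWalkAt xs c ys ω with splitWalk xs ω
  ... | _ , ω₁ , (e ▸ ω₂) = ω₁ , e ▸ ω₂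

  splitWalkAtVertex : ∀ {a b vs v} → Walk⁻ a b vs → v ∈ vs ∷ʳ b →
    ∃ λ X → ∃ λ Y → vs ≡ X ++ Y × Walk⁻ a v X × Walk⁻ v b Y
  splitWalkAtVertex done (here refl) = [] , [] , refl , done , done
  splitWalkAtVertex (e ▸ ω) (here refl) = [] , _ , refl , done , e ▸ ω
  splitWalkAtVertex (e ▸ ω) (there v∈) with splitWalkAtVertex ω v∈
  ... | X , Y , refl , ω₁ , ω₂ = _ ∷ X , Y , refl , e ▸ ω₁ , ω₂

  unconsArc : ∀ {a c b vs} → Walk⁻ a b (a ∷ c ∷ vs) → R a c × Walk⁻ c b (c ∷ vs)
  unconsArc (e ▸ (e′ ▸ ω)) = e , e′ ▸ ω

  start∈ : ∀ {a b vs} → Walk⁻ a b vs → a ≢ b → a ∈ vs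
  start∈ done a≢b = ⊥-elim (a≢b refl)
  start∈ (_ ▸ _) _ = here refl

  start∈∷ʳ : ∀ {a b vs} → Walk⁻ a b vs → a ∈ vs ∷ʳ b
  start∈∷ʳ done = here refl
  start∈∷ʳ (_ ▸ _) = here refl

  toWalk : ∀ {a b vs} → Walk⁻ a b vs → Walk R a b (vs ∷ʳ b)
  toWalk done = stop
  toWalk (e ▸ ω) = step e (toWalk ω)

  walkAlong : ∀ v vs e → (∀ i → R (lookup (v ∷ vs) (inject₁ i)) (lookup vs i)) →
    R (lastOf v vs) e → Walk⁻ v e (v ∷ vs)
  walkAlong v [] e _ last = last ▸ done
  walkAlong v (v′ ∷ vs) e arcs last = arcs zero ▸ walkAlong v′ vs e (λ i → arcs (suc i)) last

  walkAgainst : ∀ v vs → (∀ i → R (lookup vs i) (lookup (v ∷ vs) (inject₁ i))) →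
    Walk⁻ (lastOf v vs) v (reverse vs)
  walkAgainst v [] _ = done
  walkAgainst v (v′ ∷ vs) arcs =
    subst (Walk⁻ _ v) (sym (unfold-reverse v′ vs))
      (walkAgainst v′ vs (λ i → arcs (suc i)) ▸▸ arcs zero ▸ done)

  _⊆_ : List V → List V → Set
  xs ⊆ ys = ∀ {v} → v ∈ xs → v ∈ ys

  record Shortcut (a b : V) (vs : List V) : Set where
    constructor mkShortcut
    field
      path : List V
      walk : Walk⁻ a b path
      unique : Unique (path ∷ʳ b)
      path⊆ : path ⊆ vs

  shortcut : ∀ {a b vs} → Walk⁻ a b vs → Shortcut a b vs
  shortcut done = mkShortcut [] done (All.[] ∷ []) λ ()
  shortcut {a} {b} (e ▸ ω) with shortcut ω
  ... | mkShortcut vs ω′ uniq vs⊆ with a ∈? (vs ∷ʳ b)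
  ... | no a∉ = mkShortcut (a ∷ vs) (e ▸ ω′) (Unique-∷⁺ a∉ uniq) λ { (here eq) → here eq ; (there v∈) → there (vs⊆ v∈) }
  ... | yes a∈ with X , Y , refl , _ , ω″ ← splitWalkAtVertex ω′ a∈ =
    mkShortcut Y ω″ (Unique-++⁻ʳ X (subst Unique (++-assoc X Y [ b ]) uniq)) λ v∈ → there (vs⊆ (∈-++⁺ʳ X v∈))

  record LastExit (P : V → Set) (c b : V) (ws : List V) : Set where
    field
      s s′ : V
      before after : List V
      ws≡ : ws ≡ before ++ s ∷ after
      arc : R s s′
      walkAfter : Walk⁻ s′ b after
      P-s : P s
      ¬P-after : All (λ z → ¬ P z) after

  lastExit : ∀ {c b ws} (P : V → Set) → (∀ z → Dec (P z)) → Walk⁻ c b ws →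
    All (λ z → ¬ P z) ws ⊎ LastExit P c b ws
  lastExit P P? done = inj₁ All.[]
  lastExit {c} P P? (e ▸ ω) with lastExit P P? ω
  ... | inj₂ le = inj₂ (record
          { before = c ∷ before ; ws≡ = cong (c ∷_) ws≡ ; arc = arc ; walkAfter = walkAfter
          ; P-s = P-s ; ¬P-after = ¬P-after })
    where open LastExit le
  ... | inj₁ ¬P-ω with P? c
  ...   | yes P-c = inj₂ (record
          { before = [] ; ws≡ = refl ; arc = e ; walkAfter = ω ; P-s = P-c ; ¬P-after = ¬P-ω })
  ...   | no ¬P-c = inj₁ (¬P-c All.∷ ¬P-ω)

  record FirstHit (Q : V → Set) (c b : V) (ws : List V) : Set where
    field
      v : V
      before after : List V
      ws≡ : ws ≡ before ++ after
      walkBefore : Walk⁻ c v before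
      Q-v : Q v
      v∈ : v ∈ ws ∷ʳ b
      ¬Q-before : All (λ z → ¬ Q z) before

  firstHit : ∀ {c b ws} (Q : V → Set) → (∀ z → Dec (Q z)) → Walk⁻ c b ws → Q b → FirstHit Q c b ws
  firstHit Q Q? done Q-b = record
    { before = [] ; after = [] ; ws≡ = refl ; walkBefore = done ; Q-v = Q-b ; v∈ = here refl ; ¬Q-before = All.[] }
  firstHit {c} Q Q? (e ▸ ω) Q-b with Q? c
  ... | yes Q-c = record
    { before = [] ; after = _ ; ws≡ = refl ; walkBefore = done ; Q-v = Q-c ; v∈ = here refl ; ¬Q-before = All.[] }
  ... | no ¬Q-c = record
    { before = c ∷ before ; ws≡ = cong (c ∷_) ws≡ ; walkBefore = e ▸ walkBefore
    ; Q-v = Q-v ; v∈ = there v∈ ; ¬Q-before = ¬Q-c All.∷ ¬Q-before }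
    where open FirstHit (firstHit Q Q? ω Q-b)

  VertexDeletionsConnected : Set
  VertexDeletionsConnected = ∀ c x y → x ≢ c → y ≢ c → ∃ λ ws → Walk⁻ x y ws × c ∉ ws

  TwoDisjointPaths : V → V → Set
  TwoDisjointPaths a b = ∃ λ P₁ → ∃ λ P₂ →
    IsPath R a b P₁ × IsPath R a b P₂ × P₁ ≢ P₂ × (∀ v → v ∈ P₁ → v ∈ P₂ → v ≡ a ⊎ v ≡ b)

  -- Two a–m paths A, B meeting only at a, continued by an m–b path C that avoids both.
  -- Each round reroutes through a bypass around m and shortens C; when m = b we are done,
  -- and A≢B makes the two final paths differ.
  module Leapfrog (a b : V) (a≢b : a ≢ b) (connected : VertexDeletionsConnected) where

    record State : Set where
      field
        m : V
        A B C : List V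
        walkA : Walk⁻ a m A
        walkB : Walk⁻ a m B
        walkC : Walk⁻ m b C
        uniqueA : Unique A
        uniqueB : Unique B
        uniqueC : Unique (C ∷ʳ b)
        A#C : Disjoint A (C ∷ʳ b)
        B#C : Disjoint B (C ∷ʳ b)
        A∩B : ∀ {z} → z ∈ A → z ∈ B → z ≡ a
        m≢a : m ≢ a
        A≢B : m ≢ b ⊎ ∃ λ x → x ∈ B × x ≢ a

    b∈∷ʳb : ∀ {zs} → b ∈ zs ∷ʳ b
    b∈∷ʳb = ∈-∷ʳ⁺ (inj₂ refl)

    module _ (st : State) where
      open State st

      record Bypass : Set where
        field
          s v : V
          S : List V
          walkS : Walk⁻ s v S
          uniqueS : Unique S
          s∈A⊎B : s ∈ A ⊎ s ∈ B
          v∈C : v ∈ C ∷ʳ b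
          v≢m : v ≢ m
          S-fresh : ∀ {z} → z ∈ S → z ≡ s ⊎ (z ∉ A × z ∉ B × z ∉ C ∷ʳ b)

      -- Follow an a–b walk avoiding m from its last vertex on A ∪ B to its first vertex on C.
      bypass : m ≢ b → Bypass
      bypass m≢b with ws , walk , m∉ws ← connected m a b (λ eq → m≢a (sym eq)) (λ eq → m≢b (sym eq)) = record
        { s = s ; v = v ; S = path ; walkS = Shortcut.walk short ; uniqueS = proj₁ (Unique-∷ʳ⁻ unique)
        ; s∈A⊎B = P-s ; v∈C = Q-v ; v≢m = v≢m ; S-fresh = S-fresh }
        where
        P : V → Set
        P z = z ∈ A ⊎ z ∈ B
        P? : ∀ z → Dec (P z)
        P? z with z ∈? A | z ∈? B
        ... | yes z∈A | _ = yes (inj₁ z∈A)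
        ... | no _ | yes z∈B = yes (inj₂ z∈B)
        ... | no z∉A | no z∉B = no λ { (inj₁ z∈A) → z∉A z∈A ; (inj₂ z∈B) → z∉B z∈B }
        a∈A : a ∈ A
        a∈A = start∈ walkA (λ eq → m≢a (sym eq))
        exit : LastExit P a b ws
        exit with lastExit P P? walk
        ... | inj₂ le = le
        ... | inj₁ ¬P-ws = ⊥-elim (All.lookup ¬P-ws (start∈ walk a≢b) (inj₁ a∈A))
        open LastExit exit
        hit : FirstHit (_∈ C ∷ʳ b) s′ b after
        hit = firstHit (_∈ C ∷ʳ b) (_∈? C ∷ʳ b) walkAfter b∈∷ʳb
        open FirstHit hit using (v; Q-v; walkBefore; ¬Q-before) renaming (before to T; ws≡ to after≡; v∈ to v∈after)
        v≢m : v ≢ m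
        v≢m v≡m with ∈-∷ʳ⁻ after v∈after
        ... | inj₁ v∈after = m∉ws (subst (_∈ ws) v≡m (subst (v ∈_) (sym ws≡) (∈-++⁺ʳ before (there v∈after))))
        ... | inj₂ v≡b = m≢b (trans (sym v≡m) v≡b)
        short : Shortcut s v (s ∷ T)
        short = shortcut (arc ▸ walkBefore)
        open Shortcut short using (path; unique; path⊆)
        S-fresh : ∀ {z} → z ∈ path → z ≡ s ⊎ (z ∉ A × z ∉ B × z ∉ C ∷ʳ b)
        S-fresh z∈ with path⊆ z∈
        ... | here z≡s = inj₁ z≡s
        ... | there z∈T = inj₂ ( (λ z∈A → ¬P z∈T (inj₁ z∈A)) , (λ z∈B → ¬P z∈T (inj₂ z∈B))
                               , All.lookup ¬Q-before z∈T )
          where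
          ¬P : ∀ {z} → z ∈ T → ¬ P z
          ¬P z∈T = All.lookup ¬P-after (subst (_ ∈_) (sym after≡) (∈-++⁺ˡ z∈T))

      -- Reroute A through the bypass; the old tail of C up to v is appended to B.
      advance : (bp : Bypass) → Bypass.s bp ∈ A → Σ State λ st′ → length (State.C st′) < length C
      advance bp s∈A
        with X , Y , C≡ , walkX , walkY ← splitWalkAtVertex walkC (Bypass.v∈C bp)
           | A₁ , A₂ , A≡ ← ∈-∃++ s∈A
        = next , subst (λ C → length Y < length C) (sym C≡) (length-++-< X m∈X)
        where
        open Bypass bp
        C∷ʳb≡ : C ∷ʳ b ≡ X ++ (Y ∷ʳ b)
        C∷ʳb≡ = trans (cong (_∷ʳ b) C≡) (++-assoc X Y [ b ])
        uniqueXY : Unique (X ++ (Y ∷ʳ b))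
        uniqueXY = subst Unique C∷ʳb≡ uniqueC
        X⊆C : X ⊆ (C ∷ʳ b)
        X⊆C z∈ = subst (_ ∈_) (sym C∷ʳb≡) (∈-++⁺ˡ z∈)
        Y⊆C : (Y ∷ʳ b) ⊆ (C ∷ʳ b)
        Y⊆C z∈ = subst (_ ∈_) (sym C∷ʳb≡) (∈-++⁺ʳ X z∈)
        m∈X : m ∈ X
        m∈X = start∈ walkX (λ eq → v≢m (sym eq))
        walkA₁ : Walk⁻ a s A₁
        walkA₁ = proj₁ (splitWalkAt A₁ s A₂ (subst (Walk⁻ a m) A≡ walkA))
        uniqueA₁s : Unique (A₁ ++ s ∷ A₂)
        uniqueA₁s = subst Unique A≡ uniqueA
        A₁⊆A : A₁ ⊆ A
        A₁⊆A z∈ = subst (_ ∈_) (sym A≡) (∈-++⁺ˡ z∈)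
        A₁#S : Disjoint A₁ S
        A₁#S (z∈A₁ , z∈S) with S-fresh z∈S
        ... | inj₁ refl = Unique-++⇒Disjoint A₁ uniqueA₁s (z∈A₁ , here refl)
        ... | inj₂ (z∉A , _) = z∉A (A₁⊆A z∈A₁)
        S#C : ∀ {z} → z ∈ S → z ∉ C ∷ʳ b
        S#C z∈S with S-fresh z∈S
        ... | inj₁ refl = λ s∈C → A#C (s∈A , s∈C)
        ... | inj₂ (_ , _ , z∉C) = z∉C
        A′#Y : Disjoint (A₁ ++ S) (Y ∷ʳ b)
        A′#Y (z∈A′ , z∈Y) with ∈-++⁻ A₁ z∈A′
        ... | inj₁ z∈A₁ = A#C (A₁⊆A z∈A₁ , Y⊆C z∈Y)
        ... | inj₂ z∈S = S#C z∈S (Y⊆C z∈Y)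
        B′#Y : Disjoint (B ++ X) (Y ∷ʳ b)
        B′#Y (z∈B′ , z∈Y) with ∈-++⁻ B z∈B′
        ... | inj₁ z∈B = B#C (z∈B , Y⊆C z∈Y)
        ... | inj₂ z∈X = Unique-++⇒Disjoint X uniqueXY (z∈X , z∈Y)
        A′∩B′ : ∀ {z} → z ∈ A₁ ++ S → z ∈ B ++ X → z ≡ a
        A′∩B′ z∈A′ z∈B′ with ∈-++⁻ A₁ z∈A′ | ∈-++⁻ B z∈B′
        ... | inj₁ z∈A₁ | inj₁ z∈B = A∩B (A₁⊆A z∈A₁) z∈B
        ... | inj₁ z∈A₁ | inj₂ z∈X = ⊥-elim (A#C (A₁⊆A z∈A₁ , X⊆C z∈X))
        ... | inj₂ z∈S | inj₂ z∈X = ⊥-elim (S#C z∈S (X⊆C z∈X))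
        ... | inj₂ z∈S | inj₁ z∈B with S-fresh z∈S
        ...   | inj₁ refl = A∩B s∈A z∈B
        ...   | inj₂ (_ , z∉B , _) = ⊥-elim (z∉B z∈B)
        v≢a : v ≢ a
        v≢a refl = A#C (start∈ walkA (λ eq → m≢a (sym eq)) , v∈C)
        next : State
        next = record
          { m = v ; A = A₁ ++ S ; B = B ++ X ; C = Y
          ; walkA = walkA₁ ▸▸ walkS ; walkB = walkB ▸▸ walkX ; walkC = walkY
          ; uniqueA = Unique.++⁺ (Unique-++⁻ˡ A₁ uniqueA₁s) uniqueS A₁#S
          ; uniqueB = Unique.++⁺ uniqueB (Unique-++⁻ˡ X uniqueXY) (λ (z∈B , z∈X) → B#C (z∈B , X⊆C z∈X))
          ; uniqueC = Unique-++⁻ʳ X uniqueXY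
          ; A#C = A′#Y ; B#C = B′#Y ; A∩B = A′∩B′ ; m≢a = v≢a
          ; A≢B = inj₂ (m , ∈-++⁺ʳ B m∈X , m≢a) }

    swap : (st : State) → State.m st ≢ b → State
    swap st m≢b = record st
      { A = B ; B = A ; walkA = walkB ; walkB = walkA ; uniqueA = uniqueB ; uniqueB = uniqueA
      ; A#C = B#C ; B#C = A#C ; A∩B = λ z∈B z∈A → A∩B z∈A z∈B ; A≢B = inj₁ m≢b }
      where open State st

    swapBypass : ∀ st (m≢b : State.m st ≢ b) → Bypass st → Bypass (swap st m≢b)
    swapBypass st m≢b bp = record
      { walkS = walkS ; uniqueS = uniqueS ; v∈C = v∈C ; v≢m = v≢m
      ; s∈A⊎B = Sum.swap s∈A⊎B
      ; S-fresh = λ z∈S → Sum.map₂ (λ (z∉A , z∉B , z∉C) → z∉B , z∉A , z∉C) (S-fresh z∈S) }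
      where open Bypass bp

    round : (st : State) → State.m st ≢ b → Σ State λ st′ → length (State.C st′) < length (State.C st)
    round st m≢b with bypass st m≢b
    ... | bp with Bypass.s∈A⊎B bp
    ...   | inj₁ s∈A = advance st bp s∈A
    ...   | inj₂ s∈B = advance (swap st m≢b) (swapBypass st m≢b bp) s∈B

    finish : (st : State) → State.m st ≡ b → TwoDisjointPaths a b
    finish st m≡b = A ∷ʳ b , B ∷ʳ b
      , (toWalk (subst (λ m → Walk⁻ a m A) m≡b walkA) , Unique-∷ʳ⁺ uniqueA (λ b∈A → A#C (b∈A , b∈∷ʳb)))
      , (toWalk (subst (λ m → Walk⁻ a m B) m≡b walkB) , Unique-∷ʳ⁺ uniqueB (λ b∈B → B#C (b∈B , b∈∷ʳb)))
      , A∷ʳb≢B∷ʳb , meet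
      where
      open State st
      A∷ʳb≢B∷ʳb : A ∷ʳ b ≢ B ∷ʳ b
      A∷ʳb≢B∷ʳb eq with A≢B
      ... | inj₁ m≢b = m≢b m≡b
      ... | inj₂ (x , x∈B , x≢a) with ∈-∷ʳ⁻ A (subst (x ∈_) (sym eq) (∈-++⁺ˡ x∈B))
      ...   | inj₁ x∈A = x≢a (A∩B x∈A x∈B)
      ...   | inj₂ refl = B#C (x∈B , b∈∷ʳb)
      meet : ∀ v → v ∈ A ∷ʳ b → v ∈ B ∷ʳ b → v ≡ a ⊎ v ≡ b
      meet v v∈A v∈B with ∈-∷ʳ⁻ A v∈A | ∈-∷ʳ⁻ B v∈B
      ... | inj₂ v≡b | _ = inj₂ v≡b
      ... | _ | inj₂ v≡b = inj₂ v≡b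
      ... | inj₁ v∈A′ | inj₁ v∈B′ = inj₁ (A∩B v∈A′ v∈B′)

    iterate : ∀ fuel (st : State) → length (State.C st) < fuel → TwoDisjointPaths a b
    iterate (suc fuel) st C<fuel with State.m st ≟ b
    ... | yes m≡b = finish st m≡b
    ... | no m≢b with round st m≢b
    ...   | st′ , C′<C = iterate fuel st′ (≤-trans C′<C (≤-pred C<fuel))

    fromOutNeighbour : ∀ a₁ → R a a₁ → a₁ ≢ a → a₁ ≢ b → TwoDisjointPaths a b
    fromOutNeighbour a₁ e a₁≢a a₁≢b
      with _ , walk , a∉ ← connected a a₁ b a₁≢a (λ eq → a≢b (sym eq))
      with mkShortcut C walkC uniqueC C⊆ ← shortcut walk
      = iterate (suc (length C)) initial ≤-refl
      where
      a#C : Disjoint (a ∷ []) (C ∷ʳ b)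
      a#C (here refl , a∈) with ∈-∷ʳ⁻ C a∈
      ... | inj₁ a∈C = a∉ (C⊆ a∈C)
      ... | inj₂ a≡b = a≢b a≡b
      initial : State
      initial = record
        { m = a₁ ; A = a ∷ [] ; B = a ∷ [] ; C = C
        ; walkA = e ▸ done ; walkB = e ▸ done ; walkC = walkC
        ; uniqueA = All.[] ∷ [] ; uniqueB = All.[] ∷ [] ; uniqueC = uniqueC
        ; A#C = a#C ; B#C = a#C ; A∩B = λ { (here eq) _ → eq }
        ; m≢a = a₁≢a ; A≢B = inj₁ a₁≢b }

  TwoOutNeighbours : V → Set
  TwoOutNeighbours a = ∃ λ o₁ → ∃ λ o₂ → R a o₁ × R a o₂ × o₁ ≢ o₂ × o₁ ≢ a × o₂ ≢ a

  twoVertexConnected : (∃ λ x → ∃ λ y → ∃ λ z → x ≢ y × x ≢ z × y ≢ z) →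
    (∀ a → TwoOutNeighbours a) → VertexDeletionsConnected → TwoVertexConnected R
  twoVertexConnected three out connected = three , paths
    where
    paths : ∀ a b → a ≢ b → TwoDisjointPaths a b
    paths a b a≢b with out a
    ... | o₁ , o₂ , e₁ , e₂ , o₁≢o₂ , o₁≢a , o₂≢a with o₁ ≟ b
    ...   | no o₁≢b = Leapfrog.fromOutNeighbour a b a≢b connected o₁ e₁ o₁≢a o₁≢b
    ...   | yes refl = Leapfrog.fromOutNeighbour a b a≢b connected o₂ e₂ o₂≢a (λ o₂≡b → o₁≢o₂ (sym o₂≡b))

  firstArc : ∀ {v h vs vs₀} → Walk⁻ v h vs → v ≢ h → Unique (vs ∷ʳ h) → vs ⊆ vs₀ →
    ∃ λ o → R v o × o ≢ v × o ∈ vs₀ ∷ʳ h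
  firstArc done v≢h _ _ = ⊥-elim (v≢h refl)
  firstArc {h = h} (_▸_ {c = o} {vs = vs} e ω) _ (v∉ ∷ _) vs⊆ =
    o , e , (λ o≡v → All.lookup v∉ (start∈∷ʳ ω) (sym o≡v)) , o∈ (∈-∷ʳ⁻ vs (start∈∷ʳ ω))
    where
    o∈ : o ∈ vs ⊎ o ≡ h → o ∈ _ ∷ʳ h
    o∈ (inj₁ o∈vs) = ∈-++⁺ˡ (vs⊆ (there o∈vs))
    o∈ (inj₂ o≡h) = ∈-∷ʳ⁺ (inj₂ o≡h)

  twoOutNeighbours : ∀ {v h₁ h₂ vs₁ vs₂} → Walk⁻ v h₁ vs₁ → Walk⁻ v h₂ vs₂ → v ≢ h₁ → v ≢ h₂ →
    (∀ {z} → z ∈ vs₁ ∷ʳ h₁ → z ∈ vs₂ ∷ʳ h₂ → z ≡ v) → TwoOutNeighbours v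
  twoOutNeighbours ω₁ ω₂ v≢h₁ v≢h₂ meet with shortcut ω₁ | shortcut ω₂
  ... | mkShortcut _ ω₁′ u₁ ⊆₁ | mkShortcut _ ω₂′ u₂ ⊆₂ with firstArc ω₁′ v≢h₁ u₁ ⊆₁ | firstArc ω₂′ v≢h₂ u₂ ⊆₂
  ... | o₁ , e₁ , o₁≢v , o₁∈ | o₂ , e₂ , o₂≢v , o₂∈ =
    o₁ , o₂ , e₁ , e₂ , (λ { refl → o₁≢v (meet o₁∈ o₂∈) }) , o₁≢v , o₂≢v

  Walk-start∈ : ∀ {x y zs} → Walk R x y zs → x ∈ zs
  Walk-start∈ stop = here refl
  Walk-start∈ (step _ _) = here refl

  leaves-through : (S : V → Set) (c : V) → (∀ {x y} → S x → R x y → S y ⊎ y ≡ c) →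
    ∀ {x y zs} → Walk R x y zs → S x → S y ⊎ c ∈ zs
  leaves-through S c closed stop S-x = inj₁ S-x
  leaves-through S c closed (step e ω) S-x with closed S-x e
  ... | inj₂ refl = inj₂ (there (Walk-start∈ ω))
  ... | inj₁ S-y with leaves-through S c closed ω S-y
  ...   | inj₁ S-end = inj₁ S-end
  ...   | inj₂ c∈ = inj₂ (there c∈)

  enters-through : (S : V → Set) (c : V) → (∀ {x y} → S y → R x y → S x ⊎ x ≡ c) →
    ∀ {x y zs} → Walk R x y zs → S y → S x ⊎ c ∈ zs
  enters-through S c closed stop S-y = inj₁ S-y
  enters-through S c closed (step e ω) S-y with enters-through S c closed ω S-y
  ... | inj₂ c∈ = inj₂ (there c∈)
  ... | inj₁ S-x′ with closed S-x′ e
  ...   | inj₁ S-x = inj₁ S-x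
  ...   | inj₂ refl = inj₂ (here refl)

  ¬out-separator : TwoVertexConnected R → (S : V → Set) (c : V) → ¬ S c →
    (∀ {x y} → S x → R x y → S y ⊎ y ≡ c) → ∀ {a b} → S a → ¬ S b → b ≢ c → ⊥
  ¬out-separator (_ , paths) S c ¬S-c closed {a} {b} S-a ¬S-b b≢c
    with paths a b (λ a≡b → ¬S-b (subst S a≡b S-a))
  ... | _ , _ , (ω₁ , _) , (ω₂ , _) , _ , meet
    with leaves-through S c closed ω₁ S-a | leaves-through S c closed ω₂ S-a
  ... | inj₁ S-b | _ = ¬S-b S-b
  ... | _ | inj₁ S-b = ¬S-b S-b
  ... | inj₂ c∈₁ | inj₂ c∈₂ with meet c c∈₁ c∈₂
  ...   | inj₁ refl = ¬S-c S-a
  ...   | inj₂ refl = b≢c refl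

  ¬in-separator : TwoVertexConnected R → (S : V → Set) (c : V) → ¬ S c →
    (∀ {x y} → S y → R x y → S x ⊎ x ≡ c) → ∀ {a b} → ¬ S a → S b → a ≢ c → ⊥
  ¬in-separator (_ , paths) S c ¬S-c closed {a} {b} ¬S-a S-b a≢c
    with paths a b (λ a≡b → ¬S-a (subst S (sym a≡b) S-b))
  ... | _ , _ , (ω₁ , _) , (ω₂ , _) , _ , meet
    with enters-through S c closed ω₁ S-b | enters-through S c closed ω₂ S-b
  ... | inj₁ S-a | _ = ¬S-a S-a
  ... | _ | inj₁ S-a = ¬S-a S-a
  ... | inj₂ c∈₁ | inj₂ c∈₂ with meet c c∈₁ c∈₂
  ...   | inj₁ refl = a≢c refl
  ...   | inj₂ refl = ¬S-c S-b

  ¬soleSuccessor : TwoVertexConnected R → ∀ {v c b} → c ≢ v → b ≢ v → b ≢ c → ¬ (∀ {x} → R v x → x ≡ c)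
  ¬soleSuccessor tv {v} {c} c≢v b≢v b≢c sole =
    ¬out-separator tv (_≡ v) c c≢v (λ { refl e → inj₂ (sole e) }) refl b≢v b≢c

  ¬solePredecessor : TwoVertexConnected R → ∀ {v c a} → c ≢ v → a ≢ v → a ≢ c → ¬ (∀ {x} → R x v → x ≡ c)
  ¬solePredecessor tv {v} {c} c≢v a≢v a≢c sole =
    ¬in-separator tv (_≡ v) c c≢v (λ { refl e → inj₂ (sole e) }) a≢v refl a≢c

-- The cycles B^x

open Defs using (Instance; Ordering; Vtx; p; q; r; z; t; u; w; y; module Construction)

module _ {m : ℕ} where

  VertexCode : Set
  VertexCode = Fin 3 ⊎ Fin m ⊎ Fin 4 × Fin m × Fin 3

  encode : Vtx m → VertexCode
  encode p = inj₁ zero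
  encode q = inj₁ (suc zero)
  encode r = inj₁ (suc (suc zero))
  encode (z c) = inj₂ (inj₁ c)
  encode (t c j) = inj₂ (inj₂ (zero , c , j))
  encode (u c j) = inj₂ (inj₂ (suc zero , c , j))
  encode (w c j) = inj₂ (inj₂ (suc (suc zero) , c , j))
  encode (y c j) = inj₂ (inj₂ (suc (suc (suc zero)) , c , j))

  decode : VertexCode → Vtx m
  decode (inj₁ zero) = p
  decode (inj₁ (suc zero)) = q
  decode (inj₁ (suc (suc zero))) = r
  decode (inj₂ (inj₁ c)) = z c
  decode (inj₂ (inj₂ (zero , c , j))) = t c j
  decode (inj₂ (inj₂ (suc zero , c , j))) = u c j
  decode (inj₂ (inj₂ (suc (suc zero) , c , j))) = w c j
  decode (inj₂ (inj₂ (suc (suc (suc zero)) , c , j))) = y c j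

  decode-encode : ∀ v → decode (encode v) ≡ v
  decode-encode p = refl
  decode-encode q = refl
  decode-encode r = refl
  decode-encode (z c) = refl
  decode-encode (t c j) = refl
  decode-encode (u c j) = refl
  decode-encode (w c j) = refl
  decode-encode (y c j) = refl

  _≟ⱽ_ : DecidableEquality (Vtx m)
  v ≟ⱽ v′ = map′ encode-injective (cong encode) (encode v ≟ᶜ encode v′)
    where
    _≟ᶜ_ : DecidableEquality VertexCode
    _≟ᶜ_ = Sum.≡-dec Fin._≟_ (Sum.≡-dec Fin._≟_ (Product.≡-dec Fin._≟_ (Product.≡-dec Fin._≟_ Fin._≟_)))
    encode-injective : encode v ≡ encode v′ → v ≡ v′
    encode-injective eq = trans (sym (decode-encode v)) (trans (cong decode eq) (decode-encode v′))

inject₁-or-fromℕ : ∀ {n} (k : Fin (suc n)) → (∃ λ i → k ≡ inject₁ i) ⊎ k ≡ fromℕ n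
inject₁-or-fromℕ {zero} zero = inj₂ refl
inject₁-or-fromℕ {suc n} zero = inj₁ (zero , refl)
inject₁-or-fromℕ {suc n} (suc k) with inject₁-or-fromℕ k
... | inj₁ (i , refl) = inj₁ (suc i , refl)
... | inj₂ refl = inj₂ refl

constant-by-steps : ∀ {n} {A : Set} (f : Fin (suc n) → A) → (∀ i → f (inject₁ i) ≡ f (suc i)) → ∀ k → f k ≡ f zero
constant-by-steps {zero} f _ zero = refl
constant-by-steps {suc n} f steps k with inject₁-or-fromℕ k
... | inj₁ (i , refl) = constant-by-steps (f ∘ inject₁) (λ i → steps (inject₁ i)) i
... | inj₂ refl = trans (sym (steps (fromℕ n))) (constant-by-steps (f ∘ inject₁) (λ i → steps (inject₁ i)) (fromℕ n))

module _ (I : Instance) (O : Ordering I) where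
  open Instance I
  open Ordering O
  open Construction I O

  next-inject₁ : ∀ {k} (i : Fin k) → next (inject₁ i) ≡ suc i
  next-inject₁ {suc k} zero = refl
  next-inject₁ {suc k} (suc i) rewrite next-inject₁ i = refl

  next-fromℕ : ∀ k → next (fromℕ k) ≡ zero
  next-fromℕ zero = refl
  next-fromℕ (suc k) rewrite next-fromℕ k = refl

  next-injective : ∀ {k} (i i′ : Fin (suc k)) → next i ≡ next i′ → i ≡ i′
  next-injective i i′ eq with inject₁-or-fromℕ i | inject₁-or-fromℕ i′
  ... | inj₁ (j , refl) | inj₁ (j′ , refl) =
    cong inject₁ (Fin.suc-injective (trans (sym (next-inject₁ j)) (trans eq (next-inject₁ j′))))
  ... | inj₁ (j , refl) | inj₂ refl with () ← trans (sym (next-inject₁ j)) (trans eq (next-fromℕ _))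
  ... | inj₂ refl | inj₁ (j′ , refl) with () ← trans (sym (next-fromℕ _)) (trans eq (next-inject₁ j′))
  ... | inj₂ refl | inj₂ refl = refl

  segment : Fin m × Fin 3 → List (Vtx m)
  segment (c , j) = y c j ∷ w c j ∷ t c j ∷ []

  cycleTail : Fin n → List (Vtx m)
  cycleTail x = concatMap segment (ord x)

  OnCycle : Vtx m → Set
  OnCycle r = ⊤
  OnCycle (y _ _) = ⊤
  OnCycle (w _ _) = ⊤
  OnCycle (t _ _) = ⊤
  OnCycle _ = ⊥

  cycleOwner : Vtx m → Maybe (Fin n)
  cycleOwner (y c j) = just (cl c j)
  cycleOwner (w c j) = just (cl c j)
  cycleOwner (t c j) = just (cl c j)
  cycleOwner _ = nothing

  concatMap-segment-++ : ∀ xs ys → concatMap segment (xs ++ ys) ≡ concatMap segment xs ++ concatMap segment ys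
  concatMap-segment-++ [] ys = refl
  concatMap-segment-++ (o ∷ xs) ys =
    trans (cong (segment o ++_) (concatMap-segment-++ xs ys)) (sym (++-assoc (segment o) (concatMap segment xs) _))

  All-OnCycle-concatMap : ∀ os → All OnCycle (concatMap segment os)
  All-OnCycle-concatMap [] = All.[]
  All-OnCycle-concatMap (o ∷ os) = tt All.∷ tt All.∷ tt All.∷ All-OnCycle-concatMap os

  All-OnCycle-Bs : ∀ x → All OnCycle (Bs x)
  All-OnCycle-Bs x = tt All.∷ All-OnCycle-concatMap (ord x)

  segment-disjoint : ∀ {v} o o′ → v ∈ segment o → v ∈ segment o′ → o ≡ o′
  segment-disjoint _ _ (here refl) (here refl) = refl
  segment-disjoint _ _ (there (here refl)) (there (here refl)) = refl
  segment-disjoint _ _ (there (there (here refl))) (there (there (here refl))) = refl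
  segment-disjoint _ _ (here refl) (there (here ()))
  segment-disjoint _ _ (here refl) (there (there (here ())))
  segment-disjoint _ _ (there (here refl)) (here ())
  segment-disjoint _ _ (there (here refl)) (there (there (here ())))
  segment-disjoint _ _ (there (there (here refl))) (here ())
  segment-disjoint _ _ (there (there (here refl))) (there (here ()))

  Unique-concatMap-segment : ∀ os → Unique os → Unique (concatMap segment os)
  Unique-concatMap-segment [] _ = []
  Unique-concatMap-segment (o ∷ os) (o∉ ∷ unique) =
    Unique.++⁺ (((λ ()) All.∷ (λ ()) All.∷ All.[]) ∷ ((λ ()) All.∷ All.[]) ∷ All.[] ∷ [])
      (Unique-concatMap-segment os unique) segment#rest
    where
    segment#rest : Disjoint (segment o) (concatMap segment os)
    segment#rest (v∈o , v∈os) with find (∈-concatMap⁻ segment {xs = os} v∈os)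
    ... | o′ , o′∈os , v∈o′ = All.lookup o∉ o′∈os (segment-disjoint o o′ v∈o v∈o′)

  Unique-cycleTail : ∀ x → Unique (cycleTail x)
  Unique-cycleTail x = Unique-concatMap-segment (ord x) (ord-uniq x)

  cycleOwner-cycleTail : ∀ x {v} → v ∈ cycleTail x → cycleOwner v ≡ just x
  cycleOwner-cycleTail x v∈ with find (∈-concatMap⁻ segment {xs = ord x} v∈)
  ... | (c , j) , o∈ , here refl = cong just (All.lookup (ord-sound x) o∈)
  ... | (c , j) , o∈ , there (here refl) = cong just (All.lookup (ord-sound x) o∈)
  ... | (c , j) , o∈ , there (there (here refl)) = cong just (All.lookup (ord-sound x) o∈)

  Unique-Bs : ∀ x → Unique (Bs x)
  Unique-Bs x = Unique-∷⁺ (λ r∈ → case cycleOwner-cycleTail x r∈ of λ ()) (Unique-cycleTail x)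

  record Split (c : Fin m) (j : Fin 3) : Set where
    field
      P Q : List (Vtx m)
      cycleTail≡ : cycleTail (cl c j) ≡ P ++ y c j ∷ w c j ∷ t c j ∷ Q
      P-on : All OnCycle P
      Q-on : All OnCycle Q
      w∉P : w c j ∉ P
      t∉P : t c j ∉ P

  split : ∀ c j → Split c j
  split c j with ∈-∃++ (ord-compl (cl c j) c j refl)
  ... | os₁ , os₂ , ord≡ = record
    { P = P ; Q = Q ; cycleTail≡ = cycleTail≡
    ; P-on = All.++⁻ˡ P on ; Q-on = All.drop⁺ 3 (All.++⁻ʳ P on)
    ; w∉P = λ w∈ → Unique-++⇒Disjoint P unique (w∈ , there (here refl))
    ; t∉P = λ t∈ → Unique-++⇒Disjoint P unique (t∈ , there (there (here refl))) }
    where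
    P Q : List (Vtx m)
    P = concatMap segment os₁
    Q = concatMap segment os₂
    cycleTail≡ : cycleTail (cl c j) ≡ P ++ y c j ∷ w c j ∷ t c j ∷ Q
    cycleTail≡ = trans (cong (concatMap segment) ord≡) (concatMap-segment-++ os₁ ((c , j) ∷ os₂))
    on : All OnCycle (P ++ y c j ∷ w c j ∷ t c j ∷ Q)
    on = subst (All OnCycle) cycleTail≡ (All-OnCycle-concatMap (ord (cl c j)))
    unique : Unique (P ++ y c j ∷ w c j ∷ t c j ∷ Q)
    unique = subst Unique cycleTail≡ (Unique-cycleTail (cl c j))

  OnCycle-≡b : ∀ {a} x k → a ≡ b x k → OnCycle a
  OnCycle-≡b x k refl = All.lookup (All-OnCycle-Bs x) (∈-lookup k)

  b≢r : ∀ x κ → κ ≢ zero → b x κ ≢ r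
  b≢r x κ κ≢0 eq = κ≢0 (lookup-injective (Unique-Bs x) κ zero eq)

  owner-b : ∀ x k {v} → b x k ≡ v → v ≢ r → cycleOwner v ≡ just x
  owner-b x k refl v≢r with ∈-lookup {xs = Bs x} k
  ... | here b≡r = ⊥-elim (v≢r b≡r)
  ... | there b∈ = cycleOwner-cycleTail x b∈

  owner≡ : ∀ x k {v x′} → b x k ≡ v → cycleOwner v ≡ just x′ → v ≢ r → x ≡ x′
  owner≡ x k b≡v owned v≢r = Maybe.just-injective (trans (sym (owner-b x k b≡v v≢r)) owned)

  CyclePosition : Set
  CyclePosition = Σ (Fin n) (Fin ∘ len)

  cyclePosition-unique : ∀ {x x′ k k′} → b x′ k′ ≡ b x k → b x k ≢ r →
    _≡_ {A = CyclePosition} (x′ , k′) (x , k)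
  cyclePosition-unique {x} {x′} {k} {k′} eq b≢r
    with refl ← owner≡ x′ k′ eq (owner-b x k refl b≢r) b≢r
    with refl ← lookup-injective (Unique-Bs x) k′ k eq = refl

  adjacent-position : ∀ (v₀ : Vtx m) vs a a′ ws →
    ∃ λ (i : Fin (length (vs ++ a ∷ a′ ∷ ws))) →
      lookup (v₀ ∷ vs ++ a ∷ a′ ∷ ws) (inject₁ i) ≡ a × lookup (vs ++ a ∷ a′ ∷ ws) i ≡ a′
  adjacent-position v₀ [] a a′ ws = suc zero , refl , refl
  adjacent-position v₀ (v ∷ vs) a a′ ws with adjacent-position v vs a a′ ws
  ... | i , eq , eq′ = suc i , eq , eq′

  next-adjacent : ∀ x k {a a′} vs ws → cycleTail x ≡ vs ++ a ∷ a′ ∷ ws → b x k ≡ a → b x (next k) ≡ a′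
  next-adjacent x k {a} {a′} vs ws tail≡ b≡a
    with i , eq , eq′ ← subst (λ L → ∃ λ (i : Fin (length L)) → lookup (r ∷ L) (inject₁ i) ≡ a × lookup L i ≡ a′)
                              (sym tail≡) (adjacent-position r vs a a′ ws)
    with refl ← lookup-injective (Unique-Bs x) k (inject₁ i) (trans b≡a (sym eq))
    = trans (cong (b x) (next-inject₁ i)) eq′

  next-y : ∀ c j x k → b x k ≡ y c j → b x (next k) ≡ w c j
  next-y c j x k b≡y with refl ← owner≡ x k b≡y refl (λ ())
    = next-adjacent x k P (t c j ∷ Q) cycleTail≡ b≡y
    where open Split (split c j)

  next-w : ∀ c j x k → b x k ≡ w c j → b x (next k) ≡ t c j
  next-w c j x k b≡w with refl ← owner≡ x k b≡w refl (λ ())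
    = next-adjacent x k (P ++ y c j ∷ []) Q (trans cycleTail≡ (sym (++-assoc P (y c j ∷ []) _))) b≡w
    where open Split (split c j)

  module _ (Or : Orientation) where
    open Orientation Or renaming (zu to toZ)
    open Digraph _≟ⱽ_ (Arc Or)
    open import Data.List.Membership.DecPropositional (_≟ⱽ_ {m}) using (_∈?_)

    forwardCycleWalk : ∀ x → Forward Or x → Walk⁻ r r (r ∷ cycleTail x)
    forwardCycleWalk x F = walkAlong r (cycleTail x) r arcs closing
      where
      arcs : ∀ i → Arc Or (lookup (Bs x) (inject₁ i)) (lookup (cycleTail x) i)
      arcs i = subst (Arc Or (b x (inject₁ i)) ∘ b x) (next-inject₁ i) (fw x (inject₁ i) (F (inject₁ i)))
      closing : Arc Or (lastOf r (cycleTail x)) r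
      closing = subst (λ v → Arc Or v r) (lookup-fromℕ r (cycleTail x))
        (subst (Arc Or (b x (fromℕ _)) ∘ b x) (next-fromℕ _) (fw x (fromℕ _) (F _)))

    backwardCycleWalk : ∀ x → Backward Or x → Walk⁻ r r (r ∷ reverse (cycleTail x))
    backwardCycleWalk x B = closing ▸ walkAgainst r (cycleTail x) arcs
      where
      arcs : ∀ i → Arc Or (lookup (cycleTail x) i) (lookup (Bs x) (inject₁ i))
      arcs i = subst (λ k → Arc Or (b x k) (b x (inject₁ i))) (next-inject₁ i) (bw x (inject₁ i) (B (inject₁ i)))
      closing : Arc Or r (lastOf r (cycleTail x))
      closing = subst (Arc Or r) (lookup-fromℕ r (cycleTail x))
        (subst (λ k → Arc Or (b x k) (b x (fromℕ _))) (next-fromℕ _) (bw x (fromℕ _) (B _)))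

    -- Sufficiency: fans through the triangle pqr

    data Hub : Set where
      hp hq hr : Hub

    hub : Hub → Vtx m
    hub hp = p
    hub hq = q
    hub hr = r

    hubArc : ∀ h h′ → hub h ≢ hub h′ → Arc Or (hub h) (hub h′)
    hubArc hp hq _ = pq
    hubArc hp hr _ = pr
    hubArc hq hp _ = qp
    hubArc hq hr _ = qr
    hubArc hr hp _ = rp
    hubArc hr hq _ = rq
    hubArc hp hp h≢h = ⊥-elim (h≢h refl)
    hubArc hq hq h≢h = ⊥-elim (h≢h refl)
    hubArc hr hr h≢h = ⊥-elim (h≢h refl)

    record OutFan (v : Vtx m) : Set where
      field
        h₁ h₂ : Hub
        L₁ L₂ : List (Vtx m)
        walk₁ : Walk⁻ v (hub h₁) L₁
        walk₂ : Walk⁻ v (hub h₂) L₂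
        meet : ∀ {x} → x ∈ L₁ ∷ʳ hub h₁ → x ∈ L₂ ∷ʳ hub h₂ → x ≡ v

    record InFan (v : Vtx m) : Set where
      field
        h₁ h₂ : Hub
        L₁ L₂ : List (Vtx m)
        walk₁ : Walk⁻ (hub h₁) v L₁
        walk₂ : Walk⁻ (hub h₂) v L₂
        L₁#L₂ : Disjoint L₁ L₂

    module ForwardFans (c : Fin m) (j : Fin 3) (F : Forward Or (cl c j)) (toZ≡true : toZ c j ≡ true) where
      open Split (split c j)

      cycle : Walk⁻ r r (r ∷ P ++ y c j ∷ w c j ∷ t c j ∷ Q)
      cycle = subst (Walk⁻ r r ∘ (r ∷_)) cycleTail≡ (forwardCycleWalk (cl c j) F)

      r⇝y : Walk⁻ r (y c j) (r ∷ P)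
      r⇝y = proj₁ (splitWalkAt (r ∷ P) (y c j) _ cycle)

      y⇝r : Walk⁻ (y c j) r (y c j ∷ w c j ∷ t c j ∷ Q)
      y⇝r = proj₂ (splitWalkAt (r ∷ P) (y c j) _ cycle)

      y→w : Arc Or (y c j) (w c j)
      y→w = proj₁ (unconsArc y⇝r)

      w⇝r : Walk⁻ (w c j) r (w c j ∷ t c j ∷ Q)
      w⇝r = proj₂ (unconsArc y⇝r)

      w→t : Arc Or (w c j) (t c j)
      w→t = proj₁ (unconsArc w⇝r)

      t⇝r : Walk⁻ (t c j) r (t c j ∷ Q)
      t⇝r = proj₂ (unconsArc w⇝r)

      Q∷ʳr-on : All OnCycle (Q ∷ʳ r)
      Q∷ʳr-on = All.∷ʳ⁺ Q-on tt

      rPy-on : All OnCycle (r ∷ P ++ y c j ∷ [])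
      rPy-on = tt All.∷ All.++⁺ P-on (tt All.∷ All.[])

      t∉rPy : t c j ∉ r ∷ P ++ y c j ∷ []
      t∉rPy (there t∈) with ∈-++⁻ P t∈
      ... | inj₁ t∈P = t∉P t∈P
      ... | inj₂ (here ())

      out-y : OutFan (y c j)
      out-y = record { h₁ = hq ; h₂ = hr ; walk₁ = yu c j ▸ uz c j toZ≡true ▸ zq c ▸ done ; walk₂ = y⇝r ; meet = meet }
        where
        meet : ∀ {x} → x ∈ y c j ∷ u c j ∷ z c ∷ q ∷ [] → x ∈ (y c j ∷ w c j ∷ t c j ∷ Q) ∷ʳ r → x ≡ y c j
        meet (here refl) _ = refl
        meet (there (here refl)) x∈ = ⊥-elim (All.lookup (tt All.∷ tt All.∷ tt All.∷ Q∷ʳr-on) x∈)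
        meet (there (there (here refl))) x∈ = ⊥-elim (All.lookup (tt All.∷ tt All.∷ tt All.∷ Q∷ʳr-on) x∈)
        meet (there (there (there (here refl)))) x∈ = ⊥-elim (All.lookup (tt All.∷ tt All.∷ tt All.∷ Q∷ʳr-on) x∈)

      out-w : OutFan (w c j)
      out-w = record { h₁ = hq ; h₂ = hr ; walk₁ = wq c j ▸ done ; walk₂ = w⇝r ; meet = meet }
        where
        meet : ∀ {x} → x ∈ w c j ∷ q ∷ [] → x ∈ (w c j ∷ t c j ∷ Q) ∷ʳ r → x ≡ w c j
        meet (here refl) _ = refl
        meet (there (here refl)) x∈ = ⊥-elim (All.lookup (tt All.∷ tt All.∷ Q∷ʳr-on) x∈)

      out-t : OutFan (t c j)
      out-t = record { h₁ = hq ; h₂ = hr ; walk₁ = tu c j ▸ uz c j toZ≡true ▸ zq c ▸ done ; walk₂ = t⇝r ; meet = meet }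
        where
        meet : ∀ {x} → x ∈ t c j ∷ u c j ∷ z c ∷ q ∷ [] → x ∈ (t c j ∷ Q) ∷ʳ r → x ≡ t c j
        meet (here refl) _ = refl
        meet (there (here refl)) x∈ = ⊥-elim (All.lookup (tt All.∷ Q∷ʳr-on) x∈)
        meet (there (there (here refl))) x∈ = ⊥-elim (All.lookup (tt All.∷ Q∷ʳr-on) x∈)
        meet (there (there (there (here refl)))) x∈ = ⊥-elim (All.lookup (tt All.∷ Q∷ʳr-on) x∈)

      out-u : OutFan (u c j)
      out-u = record { h₁ = hq ; h₂ = hr ; walk₁ = uz c j toZ≡true ▸ zq c ▸ done ; walk₂ = uw c j ▸ w⇝r ; meet = meet }
        where
        meet : ∀ {x} → x ∈ u c j ∷ z c ∷ q ∷ [] → x ∈ (u c j ∷ w c j ∷ t c j ∷ Q) ∷ʳ r → x ≡ u c j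
        meet (here refl) _ = refl
        meet (there (here refl)) (there x∈) = ⊥-elim (All.lookup (tt All.∷ tt All.∷ Q∷ʳr-on) x∈)
        meet (there (there (here refl))) (there x∈) = ⊥-elim (All.lookup (tt All.∷ tt All.∷ Q∷ʳr-on) x∈)

      in-y : InFan (y c j)
      in-y = record { h₁ = hr ; h₂ = hp ; walk₁ = r⇝y ; walk₂ = pt c j ▸ tu c j ▸ uy c j ▸ done ; L₁#L₂ = disjoint }
        where
        disjoint : Disjoint (r ∷ P) (p ∷ t c j ∷ u c j ∷ [])
        disjoint (x∈ , here refl) = All.lookup (tt All.∷ P-on) x∈
        disjoint (here () , there (here refl))
        disjoint (there x∈ , there (here refl)) = t∉P x∈
        disjoint (x∈ , there (there (here refl))) = All.lookup (tt All.∷ P-on) x∈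

      in-w : InFan (w c j)
      in-w = record { h₁ = hr ; h₂ = hp ; walk₁ = r⇝y ▸▸ y→w ▸ done ; walk₂ = pt c j ▸ tu c j ▸ uw c j ▸ done ; L₁#L₂ = disjoint }
        where
        disjoint : Disjoint (r ∷ P ++ y c j ∷ []) (p ∷ t c j ∷ u c j ∷ [])
        disjoint (x∈ , here refl) = All.lookup rPy-on x∈
        disjoint (x∈ , there (here refl)) = t∉rPy x∈
        disjoint (x∈ , there (there (here refl))) = All.lookup rPy-on x∈

      in-t : InFan (t c j)
      in-t = record { h₁ = hp ; h₂ = hr ; walk₁ = pt c j ▸ done ; walk₂ = r⇝y ▸▸ y→w ▸ w→t ▸ done ; L₁#L₂ = disjoint }
        where
        disjoint : Disjoint (p ∷ []) (r ∷ P ++ y c j ∷ w c j ∷ [])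
        disjoint (here refl , x∈) = All.lookup (tt All.∷ All.++⁺ P-on (tt All.∷ tt All.∷ All.[])) x∈

      in-u : InFan (u c j)
      in-u = record { h₁ = hr ; h₂ = hp ; walk₁ = r⇝y ▸▸ yu c j ▸ done ; walk₂ = pt c j ▸ tu c j ▸ done ; L₁#L₂ = disjoint }
        where
        disjoint : Disjoint (r ∷ P ++ y c j ∷ []) (p ∷ t c j ∷ [])
        disjoint (x∈ , here refl) = All.lookup rPy-on x∈
        disjoint (x∈ , there (here refl)) = t∉rPy x∈

    reverse-around : ∀ (P Q : List (Vtx m)) v₁ v₂ v₃ →
      reverse (P ++ v₁ ∷ v₂ ∷ v₃ ∷ Q) ≡ reverse Q ++ v₃ ∷ v₂ ∷ v₁ ∷ reverse P
    reverse-around P Q v₁ v₂ v₃ = begin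
      reverse (P ++ v₁ ∷ v₂ ∷ v₃ ∷ Q)               ≡⟨ reverse-++ P (v₁ ∷ v₂ ∷ v₃ ∷ Q) ⟩
      reverse (v₁ ∷ v₂ ∷ v₃ ∷ Q) ++ reverse P        ≡⟨ cong (_++ reverse P) (ʳ++-defn Q) ⟩
      (reverse Q ++ v₃ ∷ v₂ ∷ v₁ ∷ []) ++ reverse P  ≡⟨ ++-assoc (reverse Q) _ (reverse P) ⟩
      reverse Q ++ v₃ ∷ v₂ ∷ v₁ ∷ reverse P          ∎
      where open ≡-Reasoning

    All-reverse : ∀ {A : Set} {Pr : A → Set} {xs} → All Pr xs → All Pr (reverse xs)
    All-reverse all = All.tabulate λ x∈ → All.lookup all (Any.reverse⁻ x∈)

    module BackwardFans (c : Fin m) (j : Fin 3) (B : Backward Or (cl c j)) (toZ≡false : toZ c j ≡ false) where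
      open Split (split c j)

      cycle : Walk⁻ r r (r ∷ reverse Q ++ t c j ∷ w c j ∷ y c j ∷ reverse P)
      cycle = subst (Walk⁻ r r ∘ (r ∷_)) (trans (cong reverse cycleTail≡) (reverse-around P Q _ _ _))
                (backwardCycleWalk (cl c j) B)

      r⇝t : Walk⁻ r (t c j) (r ∷ reverse Q)
      r⇝t = proj₁ (splitWalkAt (r ∷ reverse Q) (t c j) _ cycle)

      t⇝r : Walk⁻ (t c j) r (t c j ∷ w c j ∷ y c j ∷ reverse P)
      t⇝r = proj₂ (splitWalkAt (r ∷ reverse Q) (t c j) _ cycle)

      t→w : Arc Or (t c j) (w c j)
      t→w = proj₁ (unconsArc t⇝r)

      w⇝r : Walk⁻ (w c j) r (w c j ∷ y c j ∷ reverse P)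
      w⇝r = proj₂ (unconsArc t⇝r)

      w→y : Arc Or (w c j) (y c j)
      w→y = proj₁ (unconsArc w⇝r)

      y⇝r : Walk⁻ (y c j) r (y c j ∷ reverse P)
      y⇝r = proj₂ (unconsArc w⇝r)

      w∉rP : w c j ∉ reverse P ∷ʳ r
      w∉rP w∈ with ∈-∷ʳ⁻ (reverse P) w∈
      ... | inj₁ w∈P = w∉P (Any.reverse⁻ w∈P)

      rP-on : All OnCycle (reverse P ∷ʳ r)
      rP-on = All.∷ʳ⁺ (All-reverse P-on) tt

      rQt-on : All OnCycle (r ∷ reverse Q ++ t c j ∷ [])
      rQt-on = tt All.∷ All.++⁺ (All-reverse Q-on) (tt All.∷ All.[])

      rQtw-on : All OnCycle (r ∷ reverse Q ++ t c j ∷ w c j ∷ [])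
      rQtw-on = tt All.∷ All.++⁺ (All-reverse Q-on) (tt All.∷ tt All.∷ All.[])

      out-y : OutFan (y c j)
      out-y = record { h₁ = hr ; h₂ = hq ; walk₁ = y⇝r ; walk₂ = yu c j ▸ uw c j ▸ wq c j ▸ done ; meet = meet }
        where
        meet : ∀ {x} → x ∈ (y c j ∷ reverse P) ∷ʳ r → x ∈ y c j ∷ u c j ∷ w c j ∷ q ∷ [] → x ≡ y c j
        meet _ (here refl) = refl
        meet x∈ (there (here refl)) = ⊥-elim (All.lookup (tt All.∷ rP-on) x∈)
        meet (here ()) (there (there (here refl)))
        meet (there x∈) (there (there (here refl))) = ⊥-elim (w∉rP x∈)
        meet x∈ (there (there (there (here refl)))) = ⊥-elim (All.lookup (tt All.∷ rP-on) x∈)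

      out-w : OutFan (w c j)
      out-w = record { h₁ = hq ; h₂ = hr ; walk₁ = wq c j ▸ done ; walk₂ = w⇝r ; meet = meet }
        where
        meet : ∀ {x} → x ∈ w c j ∷ q ∷ [] → x ∈ (w c j ∷ y c j ∷ reverse P) ∷ʳ r → x ≡ w c j
        meet (here refl) _ = refl
        meet (there (here refl)) x∈ = ⊥-elim (All.lookup (tt All.∷ tt All.∷ rP-on) x∈)

      out-t : OutFan (t c j)
      out-t = record { h₁ = hr ; h₂ = hq ; walk₁ = tu c j ▸ uy c j ▸ y⇝r ; walk₂ = t→w ▸ wq c j ▸ done ; meet = meet }
        where
        meet : ∀ {x} → x ∈ (t c j ∷ u c j ∷ y c j ∷ reverse P) ∷ʳ r → x ∈ t c j ∷ w c j ∷ q ∷ [] → x ≡ t c j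
        meet _ (here refl) = refl
        meet (there (there (there x∈))) (there (here refl)) = ⊥-elim (w∉rP x∈)
        meet (there (there x∈)) (there (there (here refl))) = ⊥-elim (All.lookup (tt All.∷ rP-on) x∈)

      out-u : OutFan (u c j)
      out-u = record { h₁ = hq ; h₂ = hr ; walk₁ = uw c j ▸ wq c j ▸ done ; walk₂ = uy c j ▸ y⇝r ; meet = meet }
        where
        meet : ∀ {x} → x ∈ u c j ∷ w c j ∷ q ∷ [] → x ∈ (u c j ∷ y c j ∷ reverse P) ∷ʳ r → x ≡ u c j
        meet (here refl) _ = refl
        meet (there (here refl)) (there (there x∈)) = ⊥-elim (w∉rP x∈)
        meet (there (there (here refl))) (there x∈) = ⊥-elim (All.lookup (tt All.∷ rP-on) x∈)

      in-t : InFan (t c j)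
      in-t = record { h₁ = hp ; h₂ = hr ; walk₁ = pt c j ▸ done ; walk₂ = r⇝t ; L₁#L₂ = disjoint }
        where
        disjoint : Disjoint (p ∷ []) (r ∷ reverse Q)
        disjoint (here refl , x∈) = All.lookup (tt All.∷ All-reverse Q-on) x∈

      in-w : InFan (w c j)
      in-w = record { h₁ = hp ; h₂ = hr ; walk₁ = pz c ▸ zu c j toZ≡false ▸ uw c j ▸ done ; walk₂ = r⇝t ▸▸ t→w ▸ done ; L₁#L₂ = disjoint }
        where
        disjoint : Disjoint (p ∷ z c ∷ u c j ∷ []) (r ∷ reverse Q ++ t c j ∷ [])
        disjoint (here refl , x∈) = All.lookup rQt-on x∈
        disjoint (there (here refl) , x∈) = All.lookup rQt-on x∈
        disjoint (there (there (here refl)) , x∈) = All.lookup rQt-on x∈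

      in-y : InFan (y c j)
      in-y = record { h₁ = hp ; h₂ = hr ; walk₁ = pz c ▸ zu c j toZ≡false ▸ uy c j ▸ done ; walk₂ = r⇝t ▸▸ t→w ▸ w→y ▸ done ; L₁#L₂ = disjoint }
        where
        disjoint : Disjoint (p ∷ z c ∷ u c j ∷ []) (r ∷ reverse Q ++ t c j ∷ w c j ∷ [])
        disjoint (here refl , x∈) = All.lookup rQtw-on x∈
        disjoint (there (here refl) , x∈) = All.lookup rQtw-on x∈
        disjoint (there (there (here refl)) , x∈) = All.lookup rQtw-on x∈

      in-u : InFan (u c j)
      in-u = record { h₁ = hp ; h₂ = hr ; walk₁ = pz c ▸ zu c j toZ≡false ▸ done ; walk₂ = r⇝t ▸▸ tu c j ▸ done ; L₁#L₂ = disjoint }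
        where
        disjoint : Disjoint (p ∷ z c ∷ []) (r ∷ reverse Q ++ t c j ∷ [])
        disjoint (here refl , x∈) = All.lookup rQt-on x∈
        disjoint (there (here refl) , x∈) = All.lookup rQt-on x∈

    ¬Forward×Backward : ∀ x → Forward Or x → Backward Or x → ⊥
    ¬Forward×Backward x F B with () ← trans (sym (F zero)) (B zero)

    module Sufficiency (condA : CondA Or) (condB : CondB Or) (condC : CondC Or) where
      open Equivalence

      gadgetOrientation : ∀ c j →
        (Forward Or (cl c j) × toZ c j ≡ true) ⊎ (Backward Or (cl c j) × toZ c j ≡ false)
      gadgetOrientation c j with condA (cl c j)
      ... | inj₁ F = inj₁ (F , from (condB c j) F)
      ... | inj₂ B with toZ c j in toZ≡
      ...   | false = inj₂ (B , refl)
      ...   | true = ⊥-elim (¬Forward×Backward _ (to (condB c j) toZ≡) B)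

      byOrientation : ∀ {X : Set} c j → (Forward Or (cl c j) → toZ c j ≡ true → X) →
        (Backward Or (cl c j) → toZ c j ≡ false → X) → X
      byOrientation c j forward backward = Sum.[ uncurry forward , uncurry backward ] (gadgetOrientation c j)

      ¬toZ⇒backward : ∀ c j → toZ c j ≡ false → Backward Or (cl c j)
      ¬toZ⇒backward c j toZ≡false with gadgetOrientation c j
      ... | inj₂ (B , _) = B
      ... | inj₁ (_ , toZ≡true) with () ← trans (sym toZ≡true) toZ≡false

      outFan : ∀ v → OutFan v
      outFan p = record { h₁ = hp ; h₂ = hq ; walk₁ = done ; walk₂ = pq ▸ done ; meet = λ { (here refl) _ → refl } }
      outFan q = record { h₁ = hq ; h₂ = hp ; walk₁ = done ; walk₂ = qp ▸ done ; meet = λ { (here refl) _ → refl } }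
      outFan r = record { h₁ = hr ; h₂ = hp ; walk₁ = done ; walk₂ = rp ▸ done ; meet = λ { (here refl) _ → refl } }
      outFan (z c) with condC c
      ... | _ , j , _ , toZ≡false = record
        { h₁ = hq ; h₂ = hr ; walk₁ = zq c ▸ done ; walk₂ = zu c j toZ≡false ▸ uy c j ▸ y⇝r ; meet = meet }
        where
        open BackwardFans c j (¬toZ⇒backward c j toZ≡false) toZ≡false
        meet : ∀ {x} → x ∈ z c ∷ q ∷ [] → x ∈ (z c ∷ u c j ∷ y c j ∷ reverse (Split.P (split c j))) ∷ʳ r → x ≡ z c
        meet (here refl) _ = refl
        meet (there (here refl)) (there (there x∈)) = ⊥-elim (All.lookup (tt All.∷ rP-on) x∈)
      outFan (t c j) = byOrientation c j (ForwardFans.out-t c j) (BackwardFans.out-t c j)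
      outFan (u c j) = byOrientation c j (ForwardFans.out-u c j) (BackwardFans.out-u c j)
      outFan (w c j) = byOrientation c j (ForwardFans.out-w c j) (BackwardFans.out-w c j)
      outFan (y c j) = byOrientation c j (ForwardFans.out-y c j) (BackwardFans.out-y c j)

      inFan : ∀ v → InFan v
      inFan p = record { h₁ = hp ; h₂ = hq ; walk₁ = done ; walk₂ = qp ▸ done ; L₁#L₂ = λ () }
      inFan q = record { h₁ = hq ; h₂ = hp ; walk₁ = done ; walk₂ = pq ▸ done ; L₁#L₂ = λ () }
      inFan r = record { h₁ = hr ; h₂ = hp ; walk₁ = done ; walk₂ = pr ▸ done ; L₁#L₂ = λ () }
      inFan (z c) with condC c
      ... | j , _ , toZ≡true , _ = record
        { h₁ = hp ; h₂ = hr ; walk₁ = pz c ▸ done ; walk₂ = r⇝y ▸▸ yu c j ▸ uz c j toZ≡true ▸ done ; L₁#L₂ = disjoint }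
        where
        open ForwardFans c j (to (condB c j) toZ≡true) toZ≡true
        disjoint : Disjoint (p ∷ []) (r ∷ Split.P (split c j) ++ y c j ∷ u c j ∷ [])
        disjoint (here refl , there x∈) with ∈-++⁻ (Split.P (split c j)) x∈
        ... | inj₁ x∈P = All.lookup (Split.P-on (split c j)) x∈P
        ... | inj₂ (here ())
        ... | inj₂ (there (here ()))
      inFan (t c j) = byOrientation c j (ForwardFans.in-t c j) (BackwardFans.in-t c j)
      inFan (u c j) = byOrientation c j (ForwardFans.in-u c j) (BackwardFans.in-u c j)
      inFan (w c j) = byOrientation c j (ForwardFans.in-w c j) (BackwardFans.in-w c j)
      inFan (y c j) = byOrientation c j (ForwardFans.in-y c j) (BackwardFans.in-y c j)

      outAvoiding : ∀ c v → v ≢ c → ∃ λ h → ∃ λ L → Walk⁻ v (hub h) L × c ∉ L ∷ʳ hub h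
      outAvoiding c v v≢c with outFan v
      ... | record { h₁ = h₁ ; h₂ = h₂ ; L₁ = L₁ ; L₂ = L₂ ; walk₁ = walk₁ ; walk₂ = walk₂ ; meet = meet }
        with c ∈? (L₁ ∷ʳ hub h₁)
      ...   | no c∉ = h₁ , L₁ , walk₁ , c∉
      ...   | yes c∈₁ = h₂ , L₂ , walk₂ , λ c∈₂ → v≢c (sym (meet c∈₁ c∈₂))

      inAvoiding : ∀ c v → ∃ λ h → ∃ λ L → Walk⁻ (hub h) v L × c ∉ L
      inAvoiding c v with inFan v
      ... | record { h₁ = h₁ ; h₂ = h₂ ; L₁ = L₁ ; L₂ = L₂ ; walk₁ = walk₁ ; walk₂ = walk₂ ; L₁#L₂ = L₁#L₂ }
        with c ∈? L₁
      ...   | no c∉ = h₁ , L₁ , walk₁ , c∉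
      ...   | yes c∈₁ = h₂ , L₂ , walk₂ , λ c∈₂ → L₁#L₂ (c∈₁ , c∈₂)

      connected : VertexDeletionsConnected
      connected c x x′ x≢c x′≢c with outAvoiding c x x≢c | inAvoiding c x′
      ... | h , L , ω , c∉L | h′ , L′ , ω′ , c∉L′ with hub h ≟ⱽ hub h′
      ...   | yes h≡h′ = L ++ L′ , ω ▸▸ subst (λ v → Walk⁻ v x′ L′) (sym h≡h′) ω′ , c∉
        where
        c∉ : c ∉ L ++ L′
        c∉ c∈ with ∈-++⁻ L c∈
        ... | inj₁ c∈L = c∉L (∈-++⁺ˡ c∈L)
        ... | inj₂ c∈L′ = c∉L′ c∈L′
      ...   | no h≢h′ = L ++ hub h ∷ L′ , ω ▸▸ hubArc h h′ h≢h′ ▸ ω′ , c∉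
        where
        c∉ : c ∉ L ++ hub h ∷ L′
        c∉ c∈ with ∈-++⁻ L c∈
        ... | inj₁ c∈L = c∉L (∈-++⁺ˡ c∈L)
        ... | inj₂ (here c≡h) = c∉L (∈-∷ʳ⁺ (inj₂ c≡h))
        ... | inj₂ (there c∈L′) = c∉L′ c∈L′

      fromOutFan : ∀ v → (∀ h → v ≢ hub h) → TwoOutNeighbours v
      fromOutFan v v≢hub = twoOutNeighbours walk₁ walk₂ (v≢hub h₁) (v≢hub h₂) meet
        where open OutFan (outFan v)

      twoOut : ∀ v → TwoOutNeighbours v
      twoOut p = q , r , pq , pr , (λ ()) , (λ ()) , (λ ())
      twoOut q = p , r , qp , qr , (λ ()) , (λ ()) , (λ ())
      twoOut r = p , q , rp , rq , (λ ()) , (λ ()) , (λ ())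
      twoOut (z c) = fromOutFan (z c) λ { hp () ; hq () ; hr () }
      twoOut (t c j) = fromOutFan (t c j) λ { hp () ; hq () ; hr () }
      twoOut (u c j) = fromOutFan (u c j) λ { hp () ; hq () ; hr () }
      twoOut (w c j) = fromOutFan (w c j) λ { hp () ; hq () ; hr () }
      twoOut (y c j) = fromOutFan (y c j) λ { hp () ; hq () ; hr () }

      twoVertexConnected-Arc : TwoVertexConnected (Arc Or)
      twoVertexConnected-Arc = twoVertexConnected (p , q , r , (λ ()) , (λ ()) , (λ ())) twoOut connected

    -- Necessity: separating vertices

    data PlainArc : Vtx m → Vtx m → Set where
      pq : PlainArc p q
      qp : PlainArc q p
      pr : PlainArc p r
      rp : PlainArc r p
      qr : PlainArc q r
      rq : PlainArc r q
      pz : ∀ c → PlainArc p (z c)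
      zq : ∀ c → PlainArc (z c) q
      pt : ∀ c j → PlainArc p (t c j)
      tu : ∀ c j → PlainArc (t c j) (u c j)
      uy : ∀ c j → PlainArc (u c j) (y c j)
      yu : ∀ c j → PlainArc (y c j) (u c j)
      uw : ∀ c j → PlainArc (u c j) (w c j)
      wq : ∀ c j → PlainArc (w c j) q
      uz : ∀ c j → toZ c j ≡ true  → PlainArc (u c j) (z c)
      zu : ∀ c j → toZ c j ≡ false → PlainArc (z c) (u c j)

    ForwardArc BackwardArc : Vtx m → Vtx m → Set
    ForwardArc a a′ = ∃ λ x → ∃ λ k → cyc x k ≡ true × a ≡ b x k × a′ ≡ b x (next k)
    BackwardArc a a′ = ∃ λ x → ∃ λ k → cyc x k ≡ false × a ≡ b x (next k) × a′ ≡ b x k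

    -- Arc cannot be matched on directly: its cycle arcs have non-constructor endpoints b x k.
    classify : ∀ {a a′} → Arc Or a a′ → PlainArc a a′ ⊎ ForwardArc a a′ ⊎ BackwardArc a a′
    classify pq = inj₁ pq
    classify qp = inj₁ qp
    classify pr = inj₁ pr
    classify rp = inj₁ rp
    classify qr = inj₁ qr
    classify rq = inj₁ rq
    classify (pz c) = inj₁ (pz c)
    classify (zq c) = inj₁ (zq c)
    classify (pt c j) = inj₁ (pt c j)
    classify (tu c j) = inj₁ (tu c j)
    classify (uy c j) = inj₁ (uy c j)
    classify (yu c j) = inj₁ (yu c j)
    classify (uw c j) = inj₁ (uw c j)
    classify (wq c j) = inj₁ (wq c j)
    classify (uz c j e) = inj₁ (uz c j e)
    classify (zu c j e) = inj₁ (zu c j e)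
    classify (fw x k e) = inj₂ (inj₁ (x , k , e , refl , refl))
    classify (bw x k e) = inj₂ (inj₂ (x , k , e , refl , refl))

    -- Both cycle edges at b x κ point into it (a sink) or out of it (a source); the edge
    -- preceding position κ is the edge k with next k ≡ κ.
    CycleSink CycleSource : (x : Fin n) → Fin (len x) → Set
    CycleSink x κ = cyc x κ ≡ false × (∀ k → next k ≡ κ → cyc x k ≡ true)
    CycleSource x κ = cyc x κ ≡ true × (∀ k → next k ≡ κ → cyc x k ≡ false)

    noCycleArcOut : ∀ {x κ a a′} → b x κ ≢ r → CycleSink x κ → a ≡ b x κ →
      ¬ ForwardArc a a′ × ¬ BackwardArc a a′
    noCycleArcOut {x} {κ} b≢r (κ-in , prev-in) a≡ =
      (λ { (x′ , k′ , k′-out , a≡′ , _) → noForward (cyclePosition-unique (trans (sym a≡′) a≡) b≢r) k′-out })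
      , (λ { (x′ , k′ , k′-out , a≡′ , _) → noBackward (cyclePosition-unique (trans (sym a≡′) a≡) b≢r) k′-out })
      where
      noForward : ∀ {x′ k′} → _≡_ {A = CyclePosition} (x′ , k′) (x , κ) → cyc x′ k′ ≢ true
      noForward refl k-out with () ← trans (sym k-out) κ-in
      noBackward : ∀ {x′ k′} → _≡_ {A = CyclePosition} (x′ , next k′) (x , κ) → cyc x′ k′ ≢ false
      noBackward {k′ = k′} refl k-out with () ← trans (sym (prev-in k′ refl)) k-out

    noCycleArcIn : ∀ {x κ a a′} → b x κ ≢ r → CycleSource x κ → a′ ≡ b x κ →
      ¬ ForwardArc a a′ × ¬ BackwardArc a a′
    noCycleArcIn {x} {κ} b≢r (κ-out , prev-out) a′≡ =
      (λ { (x′ , k′ , k′-in , _ , a′≡′) → noForward (cyclePosition-unique (trans (sym a′≡′) a′≡) b≢r) k′-in })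
      , (λ { (x′ , k′ , k′-in , _ , a′≡′) → noBackward (cyclePosition-unique (trans (sym a′≡′) a′≡) b≢r) k′-in })
      where
      noForward : ∀ {x′ k′} → _≡_ {A = CyclePosition} (x′ , next k′) (x , κ) → cyc x′ k′ ≢ true
      noForward {k′ = k′} refl k-in with () ← trans (sym (prev-out k′ refl)) k-in
      noBackward : ∀ {x′ k′} → _≡_ {A = CyclePosition} (x′ , k′) (x , κ) → cyc x′ k′ ≢ false
      noBackward refl k-in with () ← trans (sym κ-out) k-in

    plainSuccessor : ∀ {v c₀} → (∀ {a′} → ¬ ForwardArc v a′ × ¬ BackwardArc v a′) →
      (∀ {a′} → PlainArc v a′ → a′ ≡ c₀) → ∀ {a′} → Arc Or v a′ → a′ ≡ c₀
    plainSuccessor noCycle plain arc with classify arc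
    ... | inj₁ pa = plain pa
    ... | inj₂ (inj₁ fa) = ⊥-elim (proj₁ noCycle fa)
    ... | inj₂ (inj₂ ba) = ⊥-elim (proj₂ noCycle ba)

    plainPredecessor : ∀ {v c₀} → (∀ {a} → ¬ ForwardArc a v × ¬ BackwardArc a v) →
      (∀ {a} → PlainArc a v → a ≡ c₀) → ∀ {a} → Arc Or a v → a ≡ c₀
    plainPredecessor noCycle plain arc with classify arc
    ... | inj₁ pa = plain pa
    ... | inj₂ (inj₁ fa) = ⊥-elim (proj₁ noCycle fa)
    ... | inj₂ (inj₂ ba) = ⊥-elim (proj₂ noCycle ba)

    module Necessity (tv : TwoVertexConnected (Arc Or)) where

      ¬sink : ∀ x κ → b x κ ≢ r → ¬ CycleSink x κ
      ¬sink x κ b≢r sink with ∈-lookup {xs = Bs x} κ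
      ... | here b≡r = b≢r b≡r
      ... | there b∈ with find (∈-concatMap⁻ segment {xs = ord x} b∈)
      ...   | (c , j) , _ , here b≡y = ¬soleSuccessor tv {b = p} (λ ()) (λ ()) (λ ())
              (plainSuccessor (noCycleArcOut b≢r sink (sym b≡y)) λ { (yu _ _) → refl })
      ...   | (c , j) , _ , there (here b≡w) = ¬soleSuccessor tv {b = p} (λ ()) (λ ()) (λ ())
              (plainSuccessor (noCycleArcOut b≢r sink (sym b≡w)) λ { (wq _ _) → refl })
      ...   | (c , j) , _ , there (there (here b≡t)) = ¬soleSuccessor tv {b = p} (λ ()) (λ ()) (λ ())
              (plainSuccessor (noCycleArcOut b≢r sink (sym b≡t)) λ { (tu _ _) → refl })

      ¬source : ∀ x κ → b x κ ≢ r → ¬ CycleSource x κ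
      ¬source x κ b≢r source with ∈-lookup {xs = Bs x} κ
      ... | here b≡r = b≢r b≡r
      ... | there b∈ with find (∈-concatMap⁻ segment {xs = ord x} b∈)
      ...   | (c , j) , _ , here b≡y = ¬solePredecessor tv {a = p} (λ ()) (λ ()) (λ ())
              (plainPredecessor (noCycleArcIn b≢r source (sym b≡y)) λ { (uy _ _) → refl })
      ...   | (c , j) , _ , there (here b≡w) = ¬solePredecessor tv {a = p} (λ ()) (λ ()) (λ ())
              (plainPredecessor (noCycleArcIn b≢r source (sym b≡w)) λ { (uw _ _) → refl })
      ...   | (c , j) , _ , there (there (here b≡t)) = ¬solePredecessor tv {a = q} (λ ()) (λ ()) (λ ())
              (plainPredecessor (noCycleArcIn b≢r source (sym b≡t)) λ { (pt _ _) → refl })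

      consecutive-agree : ∀ x k → next k ≢ zero → cyc x k ≡ cyc x (next k)
      consecutive-agree x k next≢0 with cyc x k in k≡ | cyc x (next k) in next≡
      ... | true | true = refl
      ... | false | false = refl
      ... | true | false = ⊥-elim (¬sink x (next k) (b≢r x (next k) next≢0)
                                 (next≡ , λ k′ eq → trans (cong (cyc x) (next-injective k′ k eq)) k≡))
      ... | false | true = ⊥-elim (¬source x (next k) (b≢r x (next k) next≢0)
                                 (next≡ , λ k′ eq → trans (cong (cyc x) (next-injective k′ k eq)) k≡))

      cyc-steps : ∀ x i → cyc x (inject₁ i) ≡ cyc x (suc i)
      cyc-steps x i = trans (consecutive-agree x (inject₁ i) (λ eq → Fin.0≢1+n (trans (sym eq) (next-inject₁ i))))
                            (cong (cyc x) (next-inject₁ i))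

      condA : CondA Or
      condA x with cyc x zero in cyc₀≡
      ... | true = inj₁ λ k → trans (constant-by-steps (cyc x) (cyc-steps x) k) cyc₀≡
      ... | false = inj₂ λ k → trans (constant-by-steps (cyc x) (cyc-steps x) k) cyc₀≡

      forward⇒toZ : ∀ c j → Forward Or (cl c j) → toZ c j ≡ true
      forward⇒toZ c j F with toZ c j in toZ≡
      ... | true = refl
      ... | false = ⊥-elim (¬out-separator tv S (w c j) (λ { (inj₁ ()) ; (inj₂ ()) }) closed {y c j} {p}
                      (inj₂ refl) (λ { (inj₁ ()) ; (inj₂ ()) }) (λ ()))
        where
        S : Vtx m → Set
        S a = a ≡ u c j ⊎ a ≡ y c j
        closed : ∀ {a a′} → S a → Arc Or a a′ → S a′ ⊎ a′ ≡ w c j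
        closed (inj₁ refl) arc with classify arc
        ... | inj₁ (uy _ _) = inj₁ (inj₂ refl)
        ... | inj₁ (uw _ _) = inj₂ refl
        ... | inj₁ (uz _ _ toZ≡true) with () ← trans (sym toZ≡true) toZ≡
        closed (inj₁ refl) arc | inj₂ (inj₁ (x , k , _ , u≡ , _)) = ⊥-elim (OnCycle-≡b x k u≡)
        closed (inj₁ refl) arc | inj₂ (inj₂ (x , k , _ , u≡ , _)) = ⊥-elim (OnCycle-≡b x (next k) u≡)
        closed (inj₂ refl) arc with classify arc
        ... | inj₁ (yu _ _) = inj₁ (inj₁ refl)
        ... | inj₂ (inj₁ (x , k , _ , y≡ , a′≡)) = inj₂ (trans a′≡ (next-y c j x k (sym y≡)))
        ... | inj₂ (inj₂ (x , k , k-in , y≡ , _)) with refl ← owner≡ x (next k) (sym y≡) refl (λ ())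
          with () ← trans (sym (F k)) k-in

      backward⇒¬toZ : ∀ c j → Backward Or (cl c j) → toZ c j ≡ false
      backward⇒¬toZ c j B with toZ c j in toZ≡
      ... | false = refl
      ... | true = ⊥-elim (¬in-separator tv S (t c j) (λ { (inj₁ ()) ; (inj₂ (inj₁ ())) ; (inj₂ (inj₂ ())) })
                     closed {p} {y c j} (λ { (inj₁ ()) ; (inj₂ (inj₁ ())) ; (inj₂ (inj₂ ())) }) (inj₂ (inj₁ refl)) (λ ()))
        where
        S : Vtx m → Set
        S a = a ≡ u c j ⊎ a ≡ y c j ⊎ a ≡ w c j
        closed : ∀ {a a′} → S a′ → Arc Or a a′ → S a ⊎ a ≡ t c j
        closed (inj₁ refl) arc with classify arc
        ... | inj₁ (tu _ _) = inj₂ refl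
        ... | inj₁ (yu _ _) = inj₁ (inj₂ (inj₁ refl))
        ... | inj₁ (zu _ _ toZ≡false) with () ← trans (sym toZ≡false) toZ≡
        closed (inj₁ refl) arc | inj₂ (inj₁ (x , k , _ , _ , u≡)) = ⊥-elim (OnCycle-≡b x (next k) u≡)
        closed (inj₁ refl) arc | inj₂ (inj₂ (x , k , _ , _ , u≡)) = ⊥-elim (OnCycle-≡b x k u≡)
        closed (inj₂ (inj₁ refl)) arc with classify arc
        ... | inj₁ (uy _ _) = inj₁ (inj₁ refl)
        ... | inj₂ (inj₂ (x , k , _ , a≡ , y≡)) = inj₁ (inj₂ (inj₂ (trans a≡ (next-y c j x k (sym y≡)))))
        ... | inj₂ (inj₁ (x , k , k-out , _ , y≡)) with refl ← owner≡ x (next k) (sym y≡) refl (λ ())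
          with () ← trans (sym k-out) (B k)
        closed (inj₂ (inj₂ refl)) arc with classify arc
        ... | inj₁ (uw _ _) = inj₁ (inj₁ refl)
        ... | inj₂ (inj₂ (x , k , _ , a≡ , w≡)) = inj₂ (trans a≡ (next-w c j x k (sym w≡)))
        ... | inj₂ (inj₁ (x , k , k-out , _ , w≡)) with refl ← owner≡ x (next k) (sym w≡) refl (λ ())
          with () ← trans (sym k-out) (B k)

      condB : CondB Or
      condB c j = mk⇔ toForward (forward⇒toZ c j)
        where
        toForward : toZ c j ≡ true → Forward Or (cl c j)
        toForward toZ≡true with condA (cl c j)
        ... | inj₁ F = F
        ... | inj₂ B with () ← trans (sym toZ≡true) (backward⇒¬toZ c j B)

      ¬all-toZ : ∀ c → ¬ (∀ j → toZ c j ≡ true)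
      ¬all-toZ c all = ¬soleSuccessor tv {b = p} (λ ()) (λ ()) (λ ()) (plainSuccessor noCycle plain)
        where
        noCycle : ∀ {a′} → ¬ ForwardArc (z c) a′ × ¬ BackwardArc (z c) a′
        noCycle = (λ (x , k , _ , z≡ , _) → OnCycle-≡b x k z≡) , (λ (x , k , _ , z≡ , _) → OnCycle-≡b x (next k) z≡)
        plain : ∀ {a′} → PlainArc (z c) a′ → a′ ≡ q
        plain (zq _) = refl
        plain (zu _ j toZ≡false) with () ← trans (sym (all j)) toZ≡false

      ¬all-fromZ : ∀ c → ¬ (∀ j → toZ c j ≡ false)
      ¬all-fromZ c all = ¬solePredecessor tv {a = q} (λ ()) (λ ()) (λ ()) (plainPredecessor noCycle plain)
        where
        noCycle : ∀ {a} → ¬ ForwardArc a (z c) × ¬ BackwardArc a (z c)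
        noCycle = (λ (x , k , _ , _ , z≡) → OnCycle-≡b x (next k) z≡) , (λ (x , k , _ , _ , z≡) → OnCycle-≡b x k z≡)
        plain : ∀ {a} → PlainArc a (z c) → a ≡ p
        plain (pz _) = refl
        plain (uz _ j toZ≡true) with () ← trans (sym (all j)) toZ≡true

      condC : CondC Or
      condC c with toZ c zero in e₀ | toZ c (suc zero) in e₁ | toZ c (suc (suc zero)) in e₂
      ... | true | true | true = ⊥-elim (¬all-toZ c λ { zero → e₀ ; (suc zero) → e₁ ; (suc (suc zero)) → e₂ })
      ... | false | false | false = ⊥-elim (¬all-fromZ c λ { zero → e₀ ; (suc zero) → e₁ ; (suc (suc zero)) → e₂ })
      ... | true | false | _ = zero , suc zero , e₀ , e₁
      ... | false | true | _ = suc zero , zero , e₁ , e₀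
      ... | true | true | false = zero , suc (suc zero) , e₀ , e₂
      ... | false | false | true = suc (suc zero) , zero , e₂ , e₀

lemma1 : (I : Instance) (O : Ordering I) (Or : Construction.Orientation I O) →
    TwoVertexConnected (Construction.Arc I O Or) ⇔
    (Construction.CondA I O Or × Construction.CondB I O Or × Construction.CondC I O Or)
lemma1 I O Or = mk⇔
  (λ tv → Necessity.condA I O Or tv , Necessity.condB I O Or tv , Necessity.condC I O Or tv)
  (λ (condA , condB , condC) → Sufficiency.twoVertexConnected-Arc I O Or condA condB condC)
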